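{- Let $F_{\underline{312}}(x,t,z)=\sum_{n\ge0}\sum_{\pi\in\mathbf I_n(3412)}x^n t^{\mathrm{occ}_{312}(\pi)}z^{\mathrm{fix}(\pi)}$. Then $aF_{\underline{312}}^2+bF_{\underline{312}}+c=0$, where $a=x^3zt+x^2-x^3z$, $b=xz+x^2+x^3z-x^3zt-x^2-1$, and $c=1$.
   Context: $\mathbf I_n(3412)$ is the set of involutions of $\{1,\dots,n\}$ with no subsequence order-isomorphic to $3412$. $\mathrm{occ}_{312}(\pi)$ is the number of indices $i$ such that $\pi_i\pi_{i+1}\pi_{i+2}$ is order-isomorphic to $312$, and $\mathrm{fix}(\pi)$ is the number of fixed points. -}

module Defs where

open import Data.Bool using (Bool; true; false; _∧_; _∨_; if_then_else_; not)
open import Data.Nat using (ℕ; zero; suc; _∸_; _<ᵇ_; _≡ᵇ_)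
import Data.Nat as N
open import Data.Fin using (Fin; toℕ)
open import Data.Vec using (Vec; []; _∷_; lookup; toList)
open import Data.List using (List; []; _∷_; [_]; map; concatMap; allFin; filter; length; upTo)
import Data.List as L
import Data.Bool.ListAction as BL
open import Data.Integer using (ℤ; +_; -[1+_]; _+_; _*_; 0ℤ)
import Data.Integer as Z

-- A permutation of {1,...,n} is encoded (0-based) as the vector of its values
-- π = (π(0), ..., π(n-1)) in Vec (Fin n) n.  Order-isomorphism of patterns is
-- unaffected by the 0-based shift.

words : (m n : ℕ) → List (Vec (Fin n) m)
words zero    n = [ [] ]
words (suc m) n = concatMap (λ v → map (λ a → a ∷ v) (allFin n)) (words m n)

anyL : {A : Set} → (A → Bool) → List A → Bool
anyL p xs = BL.any p xs

allL : {A : Set} → (A → Bool) → List A → Bool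
allL p xs = BL.all p xs

countB : {A : Set} → (A → Bool) → List A → ℕ
countB p []       = 0
countB p (x ∷ xs) = if p x then suc (countB p xs) else countB p xs

val : {n : ℕ} → Vec (Fin n) n → Fin n → ℕ
val π i = toℕ (lookup π i)

-- π is an involution: π(π(i)) = i for all i (this forces bijectivity).
isInvolution : {n : ℕ} → Vec (Fin n) n → Bool
isInvolution {n} π = allL (λ i → toℕ (lookup π (lookup π i)) ≡ᵇ toℕ i) (allFin n)

contains3412 : {n : ℕ} → Vec (Fin n) n → Bool
contains3412 {n} π =
  anyL (λ i → anyL (λ j → anyL (λ k → anyL (λ l →
      (toℕ i <ᵇ toℕ j) ∧ (toℕ j <ᵇ toℕ k) ∧ (toℕ k <ᵇ toℕ l) ∧
      (val π k <ᵇ val π l) ∧ (val π l <ᵇ val π i) ∧ (val π i <ᵇ val π j))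
    (allFin n)) (allFin n)) (allFin n)) (allFin n)

occ312L : List ℕ → ℕ
occ312L (a ∷ b ∷ c ∷ rest) =
  (if (b <ᵇ c) ∧ (c <ᵇ a) then 1 else 0) N.+ occ312L (b ∷ c ∷ rest)
occ312L _ = 0

occ312 : {n : ℕ} → Vec (Fin n) n → ℕ
occ312 π = occ312L (map toℕ (toList π))

fix : {n : ℕ} → Vec (Fin n) n → ℕ
fix {n} π = countB (λ i → val π i ≡ᵇ toℕ i) (allFin n)

-- Number of π ∈ I_n(3412) with occ_312(π) = k and fix(π) = j,
-- i.e. the coefficient of x^n t^k z^j in F_312(x,t,z).
coeffF : ℕ → ℕ → ℕ → ℕ
coeffF n k j = countB (λ π → isInvolution π ∧ not (contains3412 π)
                             ∧ (occ312 π ≡ᵇ k) ∧ (fix π ≡ᵇ j))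
                      (words n n)

-- Formal power series in x, t, z with integer coefficients:
-- S n k j is the coefficient of x^n t^k z^j.
Series : Set
Series = ℕ → ℕ → ℕ → ℤ

F312 : Series
F312 n k j = + coeffF n k j

sumTo : ℕ → (ℕ → ℤ) → ℤ
sumTo zero    f = f 0
sumTo (suc n) f = sumTo n f + f (suc n)

_⊕_ : Series → Series → Series
(f ⊕ g) n k j = f n k j + g n k j

_⊗_ : Series → Series → Series
(f ⊗ g) n k j = sumTo n (λ a → sumTo k (λ b → sumTo j (λ c →
                  f a b c * g (n ∸ a) (k ∸ b) (j ∸ c))))

mono : ℤ → ℕ → ℕ → ℕ → Series
mono coef e1 e2 e3 n k j =
  if (n ≡ᵇ e1) ∧ (k ≡ᵇ e2) ∧ (j ≡ᵇ e3) then coef else 0ℤ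

one minusOne : ℤ
one = + 1
minusOne = -[1+ 0 ]

coefA : Series
coefA = mono one 3 1 1 ⊕ (mono one 2 0 0 ⊕ mono minusOne 3 0 1)

coefB : Series
coefB = mono one 1 0 1 ⊕ (mono one 2 0 0 ⊕ (mono one 3 0 1 ⊕
        (mono minusOne 3 1 1 ⊕ (mono minusOne 2 0 0 ⊕ mono minusOne 0 0 0))))

coefC : Series
coefC = mono one 0 0 0

zeroS : Series
zeroS n k j = 0ℤ

module Submission where

-- A 3412-avoiding involution is encoded by a tree read from the left: either
-- its first entry is a fixed point, followed by a 3412-avoiding involution of
-- the larger values, or its first entry opens an arc to position m + 2 that
-- encloses a 3412-avoiding involution of the next m values and is followed by
-- one of the values above.  Fixed points and consecutive 312s add up along
-- this decomposition, except that an arc produces a 312 at its opener exactly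
-- when its inner block starts with a fixed point followed by further entries.

open import Defs
open import Relation.Binary.PropositionalEquality using (_≡_)

module Combinatorics where

  open import Data.Bool using (Bool; true; false; T; _∧_; not; if_then_else_)
  open import Data.Bool.Properties using (T-∧; T-≡; T?; ∧-zeroʳ)
  open import Data.Empty using (⊥-elim)
  open import Data.Fin using (Fin; toℕ; fromℕ<) renaming (zero to fzero; suc to fsuc)
  open import Data.Fin.Properties using (toℕ-injective; toℕ-fromℕ<; toℕ<n)
  open import Data.List using (List; []; _∷_; [_]; _++_; map; length; concatMap; allFin; upTo; filterᵇ; tabulate; cartesianProductWith)
  open import Data.List.Membership.Propositional using (_∈_; find; lose)
  open import Data.List.Membership.Propositional.Properties
    using (∈-map⁺; ∈-map⁻; ∈-++⁺ˡ; ∈-++⁺ʳ; ∈-++⁻; ∈-allFin; ∈-upTo⁺; ∈-upTo⁻; ∈-filter⁺; ∈-filter⁻; ∈-concatMap⁺; ∈-concatMap⁻; ∈-cartesianProductWith⁺; ∈-cartesianProductWith⁻)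
  open import Data.List.Membership.Propositional.Properties.WithK using (unique∧set⇒bag)
  open import Data.List.Properties using (length-map; length-++; ++-assoc; ∷-injective; map-tabulate)
  open import Data.List.Relation.Binary.BagAndSetEquality using (∼bag⇒↭)
  open import Data.List.Relation.Binary.Permutation.Propositional.Properties using (↭-length)
  open import Data.List.Relation.Unary.All using (All; []; _∷_)
  import Data.List.Relation.Unary.All as All
  open import Data.List.Relation.Unary.All.Properties using (all⁺; all⁻; ++⁺)
  open import Data.List.Relation.Unary.AllPairs using ([]; _∷_)
  open import Data.List.Relation.Unary.Any using (here; there; satisfied)
  open import Data.List.Relation.Unary.Any.Properties using (any⁺; any⁻)
  open import Data.List.Relation.Unary.Unique.Propositional using (Unique)
  import Data.List.Relation.Unary.Unique.Propositional.Properties as Unique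
  open import Data.Nat using (ℕ; zero; suc; _+_; _∸_; _≤_; _<_; _≡ᵇ_; _<ᵇ_; s≤s; z<s; s<s; s<s⁻¹; s≤s⁻¹)
  open import Data.Nat.Properties
  open import Data.Nat.Tactic.RingSolver using (solve-∀)
  open import Data.Product using (∃-syntax; _×_; _,_; proj₁; proj₂)
  open import Data.Sum using (_⊎_; inj₁; inj₂)
  open import Data.Vec using (Vec; []; _∷_; toList; lookup)
  open import Function.Base using (_∘_)
  open import Function.Bundles using (mk⇔; Equivalence)
  open import Relation.Binary.Definitions using (tri<; tri≈; tri>)
  open import Relation.Binary.PropositionalEquality hiding ([_])
  open import Relation.Nullary using (¬_)

  open Equivalence using (to; from)

  countB≡length : {A : Set} (p : A → Bool) (xs : List A) → countB p xs ≡ length (filterᵇ p xs)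
  countB≡length p [] = refl
  countB≡length p (x ∷ xs) with p x
  ... | true = cong suc (countB≡length p xs)
  ... | false = countB≡length p xs

  same-members⇒same-length : {A : Set} {xs ys : List A} → Unique xs → Unique ys →
    (∀ {z} → z ∈ xs → z ∈ ys) → (∀ {z} → z ∈ ys → z ∈ xs) → length xs ≡ length ys
  same-members⇒same-length ux uy f g = ↭-length (∼bag⇒↭ (unique∧set⇒bag ux uy (mk⇔ f g)))

  count-by-codes : {X Y Z : Set} {xs : List X} {ys : List Y} (p : X → Bool) (q : Y → Bool)
    (f : X → Z) (g : Y → Z) → (∀ {a b} → f a ≡ f b → a ≡ b) → (∀ {a b} → g a ≡ g b → a ≡ b) →
    Unique xs → Unique ys →
    (∀ {x} → x ∈ xs → T (p x) → ∃[ y ] y ∈ ys × T (q y) × g y ≡ f x) →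
    (∀ {y} → y ∈ ys → T (q y) → ∃[ x ] x ∈ xs × T (p x) × f x ≡ g y) →
    countB p xs ≡ countB q ys
  count-by-codes {xs = xs} {ys} p q f g f-inj g-inj ux uy xs→ys ys→xs = begin
    countB p xs                  ≡⟨ countB≡length p xs ⟩
    length (filterᵇ p xs)         ≡⟨ length-map f (filterᵇ p xs) ⟨
    length (map f (filterᵇ p xs)) ≡⟨ same-members⇒same-length (uniq f f-inj p ux) (uniq g g-inj q uy)
                                       (transport f g p q xs→ys) (transport g f q p ys→xs) ⟩
    length (map g (filterᵇ q ys)) ≡⟨ length-map g (filterᵇ q ys) ⟩
    length (filterᵇ q ys)         ≡⟨ countB≡length q ys ⟨
    countB q ys                  ∎
    where
    open ≡-Reasoning
    uniq : {W C : Set} {ws : List W} (h : W → C) → (∀ {a b} → h a ≡ h b → a ≡ b) → (r : W → Bool) →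
           Unique ws → Unique (map h (filterᵇ r ws))
    uniq h h-inj r u = Unique.map⁺ h-inj (Unique.filter⁺ (λ w → T? (r w)) u)
    transport : {U W C : Set} {us : List U} {ws : List W} (h : U → C) (h' : W → C) (r : U → Bool) (r' : W → Bool) →
      (∀ {u} → u ∈ us → T (r u) → ∃[ w ] w ∈ ws × T (r' w) × h' w ≡ h u) →
      ∀ {z} → z ∈ map h (filterᵇ r us) → z ∈ map h' (filterᵇ r' ws)
    transport {ws = ws} h h' r r' match z∈ with ∈-map⁻ h z∈
    ... | u , u∈ , refl with ∈-filter⁻ (λ u → T? (r u)) u∈
    ... | u∈us , ru with match u∈us ru
    ... | w , w∈ws , r'w , h'w≡hu =
      subst (_∈ map h' (filterᵇ r' ws)) h'w≡hu (∈-map⁺ h' (∈-filter⁺ (λ w → T? (r' w)) w∈ws r'w))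

  countB-++ : {A : Set} (p : A → Bool) (xs ys : List A) → countB p (xs ++ ys) ≡ countB p xs + countB p ys
  countB-++ p [] ys = refl
  countB-++ p (x ∷ xs) ys with p x
  ... | true = cong suc (countB-++ p xs ys)
  ... | false = countB-++ p xs ys

  countB-map : {A B : Set} (p : B → Bool) (f : A → B) (xs : List A) → countB p (map f xs) ≡ countB (λ x → p (f x)) xs
  countB-map p f [] = refl
  countB-map p f (x ∷ xs) with p (f x)
  ... | true = cong suc (countB-map p f xs)
  ... | false = countB-map p f xs

  countB-cong : {A : Set} (p q : A → Bool) (xs : List A) → (∀ {x} → x ∈ xs → p x ≡ q x) → countB p xs ≡ countB q xs
  countB-cong p q [] e = refl
  countB-cong p q (x ∷ xs) e with p x | q x | e (here refl)
  ... | true | true | _ = cong suc (countB-cong p q xs (λ m → e (there m)))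
  ... | false | false | _ = countB-cong p q xs (λ m → e (there m))

  countB-none : {A : Set} (p : A → Bool) (xs : List A) → (∀ {x} → x ∈ xs → p x ≡ false) → countB p xs ≡ 0
  countB-none p [] e = refl
  countB-none p (x ∷ xs) e with p x | e (here refl)
  ... | false | _ = countB-none p xs (λ m → e (there m))

  ∈-concatMap-split : {A B : Set} (f : A → List B) {xs : List A} {z : B} → z ∈ concatMap f xs → ∃[ y ] y ∈ xs × z ∈ f y
  ∈-concatMap-split f z∈ = find (∈-concatMap⁻ f z∈)

  ∈-concatMap-join : {A B : Set} (f : A → List B) {xs : List A} {y : A} {z : B} → y ∈ xs → z ∈ f y → z ∈ concatMap f xs
  ∈-concatMap-join f y∈ z∈ = ∈-concatMap⁺ f (lose y∈ z∈)

  unique-concatMap : {A B : Set} (f : A → List B) {xs : List A} → Unique xs →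
    (∀ {x} → x ∈ xs → Unique (f x)) → (∀ {x y z} → z ∈ f x → z ∈ f y → x ≡ y) → Unique (concatMap f xs)
  unique-concatMap f {[]} u uf d = []
  unique-concatMap f {x ∷ xs} (x∉xs ∷ u) uf d =
    Unique.++⁺ (uf (here refl)) (unique-concatMap f u (λ y∈ → uf (there y∈)) d) disjoint
    where
    ≢-member : ∀ {ys y} → All (λ w → ¬ x ≡ w) ys → y ∈ ys → ¬ x ≡ y
    ≢-member (b ∷ bs) (here refl) = b
    ≢-member (b ∷ bs) (there m) = ≢-member bs m
    disjoint : ∀ {v} → ¬ (v ∈ f x × v ∈ concatMap f xs)
    disjoint (v∈fx , v∈rest) with ∈-concatMap-split f v∈rest
    ... | y , y∈xs , v∈fy = ≢-member x∉xs y∈xs (d v∈fx v∈fy)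

  -- Indexing of ℕ-lists, with default value 0 outside the list.
  at : List ℕ → ℕ → ℕ
  at [] _ = 0
  at (x ∷ xs) zero = x
  at (x ∷ xs) (suc i) = at xs i

  at-++ˡ : (A B : List ℕ) {i : ℕ} → i < length A → at (A ++ B) i ≡ at A i
  at-++ˡ (x ∷ A) B {zero} _ = refl
  at-++ˡ (x ∷ A) B {suc i} (s<s i<A) = at-++ˡ A B i<A

  at-++ʳ : (A B : List ℕ) (i : ℕ) → at (A ++ B) (length A + i) ≡ at B i
  at-++ʳ [] B i = refl
  at-++ʳ (x ∷ A) B i = at-++ʳ A B i

  at-++ʳ′ : (A B : List ℕ) (i : ℕ) {k : ℕ} → k ≡ length A + i → at (A ++ B) k ≡ at B i
  at-++ʳ′ A B i refl = at-++ʳ A B i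

  All⇒at : {P : ℕ → Set} {L : List ℕ} → All P L → ∀ {i} → i < length L → P (at L i)
  All⇒at (p ∷ ps) {zero} _ = p
  All⇒at (p ∷ ps) {suc i} (s<s i<L) = All⇒at ps i<L

  at⇒All : {P : ℕ → Set} (L : List ℕ) → (∀ i → i < length L → P (at L i)) → All P L
  at⇒All [] f = []
  at⇒All (x ∷ L) f = f zero z<s ∷ at⇒All L (λ i p → f (suc i) (s<s p))

  split-at : (L : List ℕ) {i y : ℕ} → i < length L → at L i ≡ y → ∃[ S ] ∃[ R ] L ≡ S ++ (y ∷ R) × length S ≡ i
  split-at (x ∷ L) {zero} _ refl = [] , L , refl , refl
  split-at (x ∷ L) {suc i} (s<s i<L) Li≡y with split-at L i<L Li≡y
  ... | S , R , e , l = x ∷ S , R , cong (x ∷_) e , cong suc l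

  ++-cancel : (A A' B B' : List ℕ) → length A ≡ length A' → A ++ B ≡ A' ++ B' → A ≡ A' × B ≡ B'
  ++-cancel [] [] B B' _ e = refl , e
  ++-cancel (x ∷ A) (x' ∷ A') B B' l e with ∷-injective e
  ... | refl , e' with ++-cancel A A' B B' (suc-injective l) e'
  ... | refl , refl = refl , refl

  values : {n m : ℕ} → Vec (Fin n) m → List ℕ
  values v = map toℕ (toList v)

  values-injective : {n m : ℕ} {v w : Vec (Fin n) m} → values v ≡ values w → v ≡ w
  values-injective {v = []} {[]} e = refl
  values-injective {v = a ∷ v} {b ∷ w} e with ∷-injective e
  ... | a≡b , v≡w with toℕ-injective a≡b | values-injective v≡w
  ... | refl | refl = refl

  length-values : {n m : ℕ} (v : Vec (Fin n) m) → length (values v) ≡ m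
  length-values [] = refl
  length-values (a ∷ v) = cong suc (length-values v)

  at-values : {n m : ℕ} (v : Vec (Fin n) m) (i : Fin m) → toℕ (lookup v i) ≡ at (values v) (toℕ i)
  at-values (a ∷ v) fzero = refl
  at-values (a ∷ v) (fsuc i) = at-values v i

  from-values : (n m : ℕ) (L : List ℕ) → length L ≡ m → All (_< n) L → ∃[ v ] values {n} {m} v ≡ L
  from-values n zero [] _ [] = [] , refl
  from-values n (suc m) (x ∷ L) e (x<n ∷ L<n) with from-values n m L (suc-injective e) L<n
  ... | v , refl = fromℕ< x<n ∷ v , cong (_∷ values v) (toℕ-fromℕ< x<n)

  words-complete : (m n : ℕ) (v : Vec (Fin n) m) → v ∈ words m n
  words-complete zero n [] = here refl
  words-complete (suc m) n (a ∷ v) =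
    ∈-concatMap-join (λ v → map (_∷ v) (allFin n)) (words-complete m n v) (∈-map⁺ (_∷ v) (∈-allFin a))

  words-unique : (m n : ℕ) → Unique (words m n)
  words-unique zero n = [] ∷ []
  words-unique (suc m) n = unique-concatMap _ (words-unique m n)
    (λ _ → Unique.map⁺ (λ { refl → refl }) (Unique.allFin⁺ n)) same-tail
    where
    same-tail : ∀ {v w u} → u ∈ map (_∷ v) (allFin n) → u ∈ map (_∷ w) (allFin n) → v ≡ w
    same-tail u∈ u∈′ with ∈-map⁻ _ u∈ | ∈-map⁻ _ u∈′
    ... | _ , _ , refl | _ , _ , refl = refl

  -- InvolutionFrom o L: L is the value list of an involution of {o, …, o + |L| - 1},
  -- i.e. every position i holds a value o + j whose own position j holds o + i.
  InvolutionFrom : ℕ → List ℕ → Set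
  InvolutionFrom o L = ∀ i → i < length L → ∃[ j ] j < length L × at L i ≡ o + j × at L j ≡ o + i

  record Has3412 (L : List ℕ) : Set where
    constructor occurrence
    field
      i j k l : ℕ
      i<j : i < j
      j<k : j < k
      k<l : k < l
      l<L : l < length L
      Lk<Ll : at L k < at L l
      Ll<Li : at L l < at L i
      Li<Lj : at L i < at L j

  fixFrom : ℕ → List ℕ → ℕ
  fixFrom o [] = 0
  fixFrom o (x ∷ L) = if x ≡ᵇ o then suc (fixFrom (suc o) L) else fixFrom (suc o) L

  involution⇒ : {n : ℕ} (v : Vec (Fin n) n) → T (isInvolution v) → InvolutionFrom 0 (values v)
  involution⇒ {n} v inv i i<L = j , j<L , vi≡j , vj≡i
    where
    i<n = subst (i <_) (length-values v) i<L
    fi = fromℕ< i<n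
    j = toℕ (lookup v fi)
    j<L = subst (j <_) (sym (length-values v)) (toℕ<n _)
    vi≡j : at (values v) i ≡ j
    vi≡j = trans (cong (at (values v)) (sym (toℕ-fromℕ< i<n))) (sym (at-values v fi))
    vj≡i : at (values v) j ≡ i
    vj≡i = trans (sym (at-values v (lookup v fi)))
           (trans (≡ᵇ⇒≡ _ _ (All.lookup (all⁺ _ (allFin n) inv) (∈-allFin fi)))
                  (toℕ-fromℕ< i<n))

  involution⇐ : {n : ℕ} (v : Vec (Fin n) n) → InvolutionFrom 0 (values v) → T (isInvolution v)
  involution⇐ {n} v inv = all⁻ _ {xs = allFin n} (All.tabulate (λ {i} _ → ≡⇒≡ᵇ _ _ (square i)))
    where
    square : (i : Fin n) → toℕ (lookup v (lookup v i)) ≡ toℕ i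
    square i with inv (toℕ i) (subst (toℕ i <_) (sym (length-values v)) (toℕ<n i))
    ... | j , _ , vi≡j , vj≡i =
      trans (at-values v (lookup v i)) (trans (cong (at (values v)) (trans (at-values v i) vi≡j)) vj≡i)

  contains3412⇒ : {n : ℕ} (v : Vec (Fin n) n) → T (contains3412 v) → Has3412 (values v)
  contains3412⇒ {n} v c with satisfied (any⁻ _ (allFin n) c)
  ... | i , c₁ with satisfied (any⁻ _ (allFin n) c₁)
  ... | j , c₂ with satisfied (any⁻ _ (allFin n) c₂)
  ... | k , c₃ with satisfied (any⁻ _ (allFin n) c₃)
  ... | l , c₄ with to T-∧ c₄
  ... | ij , c₅ with to T-∧ c₅
  ... | jk , c₆ with to T-∧ c₆
  ... | kl , c₇ with to T-∧ c₇
  ... | vkl , c₈ with to T-∧ c₈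
  ... | vli , vij =
    occurrence (toℕ i) (toℕ j) (toℕ k) (toℕ l) (<ᵇ⇒< _ _ ij) (<ᵇ⇒< _ _ jk) (<ᵇ⇒< _ _ kl)
      (subst (toℕ l <_) (sym (length-values v)) (toℕ<n l))
      (subst₂ _<_ (at-values v k) (at-values v l) (<ᵇ⇒< _ _ vkl))
      (subst₂ _<_ (at-values v l) (at-values v i) (<ᵇ⇒< _ _ vli))
      (subst₂ _<_ (at-values v i) (at-values v j) (<ᵇ⇒< _ _ vij))

  contains3412⇐ : {n : ℕ} (v : Vec (Fin n) n) → Has3412 (values v) → T (contains3412 v)
  contains3412⇐ {n} v (occurrence i j k l i<j j<k k<l l<L vkl vli vij) =
    pick fi (pick fj (pick fk (pick fl
      (from T-∧ (<ᵇ-by ti tj i<j , from T-∧ (<ᵇ-by tj tk j<k , from T-∧ (<ᵇ-by tk tl k<l ,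
       from T-∧ (<ᵇ-by (val≡ fk tk) (val≡ fl tl) vkl , from T-∧ (<ᵇ-by (val≡ fl tl) (val≡ fi ti) vli ,
                 <ᵇ-by (val≡ fi ti) (val≡ fj tj) vij)))))))))
    where
    pick : {p : Fin n → Bool} (x : Fin n) → T (p x) → T (anyL p (allFin n))
    pick x px = any⁺ _ (lose (∈-allFin x) px)
    l<n = subst (l <_) (length-values v) l<L
    k<n = <-trans k<l l<n
    j<n = <-trans j<k k<n
    i<n = <-trans i<j j<n
    fi = fromℕ< i<n
    fj = fromℕ< j<n
    fk = fromℕ< k<n
    fl = fromℕ< l<n
    ti = toℕ-fromℕ< i<n
    tj = toℕ-fromℕ< j<n
    tk = toℕ-fromℕ< k<n
    tl = toℕ-fromℕ< l<n
    val≡ : (f : Fin n) {x : ℕ} → toℕ f ≡ x → val v f ≡ at (values v) x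
    val≡ f e = trans (at-values v f) (cong (at (values v)) e)
    <ᵇ-by : {a b a' b' : ℕ} → a ≡ a' → b ≡ b' → a' < b' → T (a <ᵇ b)
    <ᵇ-by refl refl p = <⇒<ᵇ p

  fix≡fixFrom : {n m : ℕ} (v : Vec (Fin n) m) (o : ℕ) →
    countB (λ i → toℕ (lookup v i) ≡ᵇ o + toℕ i) (allFin m) ≡ fixFrom o (values v)
  fix≡fixFrom [] o = refl
  fix≡fixFrom {m = suc m} (a ∷ v) o rewrite +-identityʳ o =
    cong (λ c → if toℕ a ≡ᵇ o then suc c else c) tail-count
    where
    p : Fin (suc m) → Bool
    p i = toℕ (lookup (a ∷ v) i) ≡ᵇ o + toℕ i
    tail-count : countB p (tabulate fsuc) ≡ fixFrom (suc o) (values v)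
    tail-count = begin
      countB p (tabulate fsuc)               ≡⟨ cong (countB p) (map-tabulate (λ i → i) fsuc) ⟨
      countB p (map fsuc (allFin m))         ≡⟨ countB-map p fsuc (allFin m) ⟩
      countB (λ i → toℕ (lookup v i) ≡ᵇ o + suc (toℕ i)) (allFin m)
        ≡⟨ countB-cong _ _ (allFin m) (λ {i} _ → cong (toℕ (lookup v i) ≡ᵇ_) (+-suc o (toℕ i))) ⟩
      countB (λ i → toℕ (lookup v i) ≡ᵇ suc o + toℕ i) (allFin m) ≡⟨ fix≡fixFrom v (suc o) ⟩
      fixFrom (suc o) (values v)             ∎
      where open ≡-Reasoning

  fix-values : {n : ℕ} (v : Vec (Fin n) n) → fix v ≡ fixFrom 0 (values v)
  fix-values v = fix≡fixFrom v 0

  -- Positions in a list of the shape  x ∷ (S ++ (y ∷ R)), the shape produced by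
  -- an arc from the first position: its opener, the inner block S, the closer y,
  -- and the remainder R.
  data ArcPosition (m r : ℕ) : ℕ → Set where
    opener : ArcPosition m r 0
    inner : ∀ p → p < m → ArcPosition m r (suc p)
    closer : ArcPosition m r (suc m)
    after : ∀ q → q < r → ArcPosition m r (suc (suc (m + q)))

  module ArcShape (x y : ℕ) (S R : List ℕ) where

    L : List ℕ
    L = x ∷ (S ++ (y ∷ R))

    length-L : length L ≡ suc (suc (length S + length R))
    length-L = cong suc (trans (length-++ S) (+-suc (length S) (length R)))

    at-inner : ∀ {p} → p < length S → at L (suc p) ≡ at S p
    at-inner = at-++ˡ S (y ∷ R)

    at-closer : at L (suc (length S)) ≡ y
    at-closer = at-++ʳ′ S (y ∷ R) 0 (sym (+-identityʳ _))

    at-after : ∀ q → at L (suc (suc (length S + q))) ≡ at R q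
    at-after q = at-++ʳ′ S (y ∷ R) (suc q) (sym (+-suc _ q))

    position : ∀ j → j < length L → ArcPosition (length S) (length R) j
    position zero _ = opener
    position (suc p) p<L with <-cmp p (length S)
    ... | tri< p<m _ _ = inner p p<m
    ... | tri≈ _ refl _ = closer
    ... | tri> _ _ m<p with m≤n⇒∃[o]m+o≡n m<p
    ... | q , refl = after q (+-cancelˡ-< (length S) _ _ (s<s⁻¹ (s<s⁻¹ (subst (suc (suc (length S + q)) <_) length-L p<L))))

    inner<L : ∀ {p} → p < length S → suc p < length L
    inner<L {p} p<m = subst (suc p <_) (sym length-L) (s<s (<-≤-trans p<m (≤-trans (m≤m+n _ _) (n≤1+n _))))

    closer<L : suc (length S) < length L
    closer<L = subst (suc (length S) <_) (sym length-L) (s<s (s≤s (m≤m+n _ _)))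

    after<L : ∀ {q} → q < length R → suc (suc (length S + q)) < length L
    after<L {q} q<r = subst (suc (suc (length S + q)) <_) (sym length-L) (s<s (s<s (+-monoʳ-< (length S) q<r)))

  after-offset : ∀ o m q → o + suc (suc (m + q)) ≡ suc (suc (o + m)) + q
  after-offset = solve-∀

  arc-involution : ∀ o S R → InvolutionFrom (suc o) S → InvolutionFrom (suc (suc (o + length S))) R →
    InvolutionFrom o (suc (o + length S) ∷ (S ++ (o ∷ R)))
  arc-involution o S R invS invR = partner
    where
    open ArcShape (suc (o + length S)) o S R
    partner : InvolutionFrom o L
    partner i i<L with position i i<L
    ... | opener = suc (length S) , closer<L , sym (+-suc o _) , trans at-closer (sym (+-identityʳ o))
    ... | closer = zero , z<s , trans at-closer (sym (+-identityʳ o)) , sym (+-suc o _)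
    ... | inner p p<m with invS p p<m
    ...   | j , j<m , e₁ , e₂ = suc j , inner<L j<m ,
            trans (at-inner p<m) (trans e₁ (sym (+-suc o j))) , trans (at-inner j<m) (trans e₂ (sym (+-suc o p)))
    partner i i<L | after q q<r with invR q q<r
    ... | j , j<r , e₁ , e₂ = suc (suc (length S + j)) , after<L j<r ,
            trans (at-after q) (trans e₁ (sym (after-offset o _ j))) , trans (at-after j) (trans e₂ (sym (after-offset o _ q)))

  -- Trees encoding 3412-avoiding involutions: leaf is the empty involution,
  -- fixed s starts with a fixed point followed by s, and arc s r starts with an
  -- arc from the first position enclosing s, followed by r.
  data Tree : Set where
    leaf : Tree
    fixed : Tree → Tree
    arc : Tree → Tree → Tree

  size : Tree → ℕ
  size leaf = 0
  size (fixed s) = suc (size s)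
  size (arc s r) = suc (suc (size s + size r))

  encode : ℕ → Tree → List ℕ
  encode o leaf = []
  encode o (fixed s) = o ∷ encode (suc o) s
  encode o (arc s r) = suc (o + size s) ∷ (encode (suc o) s ++ (o ∷ encode (suc (suc (o + size s))) r))

  length-encode : ∀ o t → length (encode o t) ≡ size t
  length-encode o leaf = refl
  length-encode o (fixed s) = cong suc (length-encode (suc o) s)
  length-encode o (arc s r) = cong suc (trans (length-++ (encode (suc o) s))
    (trans (cong₂ (λ a b → a + suc b) (length-encode (suc o) s) (length-encode _ r)) (+-suc (size s) (size r))))

  fixed-involution : ∀ o M → InvolutionFrom (suc o) M → InvolutionFrom o (o ∷ M)
  fixed-involution o M invM zero _ = zero , z<s , sym (+-identityʳ o) , sym (+-identityʳ o)
  fixed-involution o M invM (suc i) (s<s i<M) with invM i i<M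
  ... | j , j<M , e₁ , e₂ = suc j , s<s j<M , trans e₁ (sym (+-suc o j)) , trans e₂ (sym (+-suc o i))

  encode-involution : ∀ o t → InvolutionFrom o (encode o t)
  encode-involution o leaf i ()
  encode-involution o (fixed s) = fixed-involution o _ (encode-involution (suc o) s)
  encode-involution o (arc s r) =
    subst (λ m → InvolutionFrom o (suc (o + m) ∷ (S ++ (o ∷ encode (suc (suc (o + m))) r))))
      (length-encode (suc o) s) (arc-involution o S _ (encode-involution (suc o) s) (encode-involution _ r))
    where S = encode (suc o) s

  involution-range : ∀ {o L} → InvolutionFrom o L → All (λ x → o ≤ x × x < o + length L) L
  involution-range {o} {L} inv = at⇒All L bounds
    where
    bounds : ∀ i → i < length L → o ≤ at L i × at L i < o + length L
    bounds i i<L with inv i i<L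
    ... | j , j<L , e , _ = subst (o ≤_) (sym e) (m≤m+n o j) , subst (_< o + length L) (sym e) (+-monoʳ-< o j<L)

  encode-above : ∀ o t → All (o ≤_) (encode o t)
  encode-above o t = All.map proj₁ (involution-range (encode-involution o t))

  encode-below : ∀ o t → All (_< o + size t) (encode o t)
  encode-below o t = All.map (λ {x} b → subst (x <_) (cong (o +_) (length-encode o t)) (proj₂ b))
                            (involution-range (encode-involution o t))

  drop-extreme-head : (x : ℕ) (M : List ℕ) → Has3412 (x ∷ M) → All (_< x) M ⊎ All (x <_) M → Has3412 M
  drop-extreme-head x M (occurrence zero (suc j) (suc k) (suc l) _ j<k k<l l<L _ _ vij) (inj₁ M<x) =
    ⊥-elim (<-asym vij (All⇒at M<x (<-trans (s<s⁻¹ j<k) (<-trans (s<s⁻¹ k<l) (s<s⁻¹ l<L)))))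
  drop-extreme-head x M (occurrence zero (suc j) (suc k) (suc l) _ _ k<l l<L vkl vli _) (inj₂ x<M) =
    ⊥-elim (<-asym (<-trans vkl vli) (All⇒at x<M (<-trans (s<s⁻¹ k<l) (s<s⁻¹ l<L))))
  drop-extreme-head x M (occurrence (suc i) (suc j) (suc k) (suc l) i<j j<k k<l l<L vkl vli vij) _ =
    occurrence i j k l (s<s⁻¹ i<j) (s<s⁻¹ j<k) (s<s⁻¹ k<l) (s<s⁻¹ l<L) vkl vli vij

  restrict-prefix : (A B : List ℕ) → ∀ {i j k l} → i < j → j < k → k < l → l < length A →
    at (A ++ B) k < at (A ++ B) l → at (A ++ B) l < at (A ++ B) i → at (A ++ B) i < at (A ++ B) j → Has3412 A
  restrict-prefix A B {i} {j} {k} {l} i<j j<k k<l l<A vkl vli vij =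
    occurrence i j k l i<j j<k k<l l<A (subst₂ _<_ (e k<A) (e l<A) vkl) (subst₂ _<_ (e l<A) (e i<A) vli)
      (subst₂ _<_ (e i<A) (e j<A) vij)
    where
    k<A = <-trans k<l l<A
    j<A = <-trans j<k k<A
    i<A = <-trans i<j j<A
    e : ∀ {x} → x < length A → at (A ++ B) x ≡ at A x
    e = at-++ˡ A B

  restrict-suffix : (A B : List ℕ) → ∀ {i j k l} → i < j → j < k → k < l → l < length (A ++ B) →
    at (A ++ B) k < at (A ++ B) l → at (A ++ B) l < at (A ++ B) i → at (A ++ B) i < at (A ++ B) j →
    length A ≤ i → Has3412 B
  restrict-suffix A B {i} {j} {k} {l} i<j j<k k<l l<AB vkl vli vij A≤i =
    occurrence (i ∸ a) (j ∸ a) (k ∸ a) (l ∸ a) (∸-monoˡ-< i<j A≤i) (∸-monoˡ-< j<k A≤j) (∸-monoˡ-< k<l A≤k)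
      (+-cancelˡ-< a _ _ (subst₂ _<_ (sym (m+[n∸m]≡n A≤l)) (length-++ A) l<AB))
      (subst₂ _<_ (e A≤k) (e A≤l) vkl) (subst₂ _<_ (e A≤l) (e A≤i) vli) (subst₂ _<_ (e A≤i) (e A≤j) vij)
    where
    a = length A
    A≤j = ≤-trans A≤i (<⇒≤ i<j)
    A≤k = ≤-trans A≤j (<⇒≤ j<k)
    A≤l = ≤-trans A≤k (<⇒≤ k<l)
    e : ∀ {x} → a ≤ x → at (A ++ B) x ≡ at B (x ∸ a)
    e A≤x = at-++ʳ′ A B _ (sym (m+[n∸m]≡n A≤x))

  split-3412 : (A B : List ℕ) (c : ℕ) → Has3412 (A ++ B) → All (_≤ c) A → All (c <_) B → Has3412 A ⊎ Has3412 B
  split-3412 A B c (occurrence i j k l i<j j<k k<l l<AB vkl vli vij) A≤c c<B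
    with <-≤-connex l (length A) | <-≤-connex i (length A)
  ... | inj₁ l<A | _ = inj₁ (restrict-prefix A B i<j j<k k<l l<A vkl vli vij)
  ... | inj₂ A≤l | inj₂ A≤i = inj₂ (restrict-suffix A B i<j j<k k<l l<AB vkl vli vij A≤i)
  ... | inj₂ A≤l | inj₁ i<A = ⊥-elim (<-asym vli Li<Ll)
    where
    l-A<B : l ∸ length A < length B
    l-A<B = +-cancelˡ-< (length A) _ _ (subst₂ _<_ (sym (m+[n∸m]≡n A≤l)) (length-++ A) l<AB)
    Li<Ll : at (A ++ B) i < at (A ++ B) l
    Li<Ll = subst₂ _<_ (sym (at-++ˡ A B i<A)) (sym (at-++ʳ′ A B (l ∸ length A) (sym (m+[n∸m]≡n A≤l))))
              (<-≤-trans (s≤s (All⇒at A≤c i<A)) (All⇒at c<B l-A<B))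

  drop-smallest-last : (S : List ℕ) (y : ℕ) → Has3412 (S ++ [ y ]) → All (y <_) S → Has3412 S
  drop-smallest-last S y (occurrence i j k l i<j j<k k<l l<L vkl vli vij) y<S with <-≤-connex l (length S)
  ... | inj₁ l<S = restrict-prefix S [ y ] i<j j<k k<l l<S vkl vli vij
  ... | inj₂ S≤l = ⊥-elim (<-asym vkl Ll<Lk)
    where
    l≡S : l ≡ length S
    l≡S = ≤-antisym (s≤s⁻¹ (subst (l <_) (trans (length-++ S) (+-comm (length S) 1)) l<L)) S≤l
    k<S : k < length S
    k<S = subst (k <_) l≡S k<l
    Ll<Lk : at (S ++ [ y ]) l < at (S ++ [ y ]) k
    Ll<Lk = subst₂ _<_ (sym (at-++ʳ′ S [ y ] 0 (trans l≡S (sym (+-identityʳ _))))) (sym (at-++ˡ S [ y ] k<S))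
              (All⇒at y<S k<S)

  encode-avoids-3412 : ∀ o t → ¬ Has3412 (encode o t)
  encode-avoids-3412 o leaf (occurrence _ _ _ _ _ _ _ () _ _ _)
  encode-avoids-3412 o (fixed s) h =
    encode-avoids-3412 (suc o) s (drop-extreme-head o _ h (inj₂ (encode-above (suc o) s)))
  encode-avoids-3412 o (arc s r) h with split-3412 (x ∷ (S ++ [ o ])) R x (subst Has3412 regroup h) head≤x x<R
    where
    x = suc (o + size s)
    S = encode (suc o) s
    R = encode (suc x) r
    regroup : x ∷ (S ++ (o ∷ R)) ≡ (x ∷ (S ++ [ o ])) ++ R
    regroup = cong (x ∷_) (sym (++-assoc S [ o ] R))
    head≤x : All (_≤ x) (x ∷ (S ++ [ o ]))
    head≤x = ≤-refl ∷ ++⁺ (All.map <⇒≤ (encode-below (suc o) s)) (≤-trans (n≤1+n o) (s≤s (m≤m+n o (size s))) ∷ [])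
    x<R : All (x <_) R
    x<R = encode-above (suc x) r
  ... | inj₂ hR = encode-avoids-3412 _ r hR
  ... | inj₁ hA = encode-avoids-3412 (suc o) s
          (drop-smallest-last S o (drop-extreme-head x (S ++ [ o ]) hA (inj₁ S++o<x)) (encode-above (suc o) s))
    where
    x = suc (o + size s)
    S = encode (suc o) s
    S++o<x : All (_< x) (S ++ [ o ])
    S++o<x = ++⁺ (encode-below (suc o) s) (s≤s (m≤m+n o (size s)) ∷ [])

  -- An arc enclosing s creates a 312 at its opener exactly
  -- when s starts with a fixed point that is followed by further entries.
  fixT : Tree → ℕ
  fixT leaf = 0
  fixT (fixed s) = suc (fixT s)
  fixT (arc s r) = fixT s + fixT r

  arc312 : Tree → ℕ
  arc312 (fixed (fixed _)) = 1
  arc312 (fixed (arc _ _)) = 1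
  arc312 _ = 0

  occT : Tree → ℕ
  occT leaf = 0
  occT (fixed s) = occT s
  occT (arc s r) = (arc312 s + occT s) + occT r

  pattern312 : ℕ → ℕ → ℕ → ℕ
  pattern312 a b c = if (b <ᵇ c) ∧ (c <ᵇ a) then 1 else 0

  starts312 : ℕ → List ℕ → ℕ
  starts312 a (b ∷ c ∷ _) = pattern312 a b c
  starts312 a _ = 0

  occ-cons : (x : ℕ) (M : List ℕ) → occ312L (x ∷ M) ≡ starts312 x M + occ312L M
  occ-cons x [] = refl
  occ-cons x (b ∷ []) = refl
  occ-cons x (b ∷ c ∷ M) = refl

  <ᵇ-false : ∀ {a b} → b ≤ a → (a <ᵇ b) ≡ false
  <ᵇ-false {a} {b} b≤a with a <ᵇ b in eq
  ... | true = ⊥-elim (<⇒≱ (<ᵇ⇒< a b (from T-≡ eq)) b≤a)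
  ... | false = refl

  pattern312-holds : ∀ a b {c} → b < c → c < a → pattern312 a b c ≡ 1
  pattern312-holds a b b<c c<a rewrite to T-≡ (<⇒<ᵇ b<c) | to T-≡ (<⇒<ᵇ c<a) = refl

  pattern312-descent : ∀ a b {c} → c ≤ b → pattern312 a b c ≡ 0
  pattern312-descent a b c≤b rewrite <ᵇ-false c≤b = refl

  pattern312-high : ∀ a b {c} → a ≤ c → pattern312 a b c ≡ 0
  pattern312-high a b {c} a≤c rewrite <ᵇ-false a≤c | ∧-zeroʳ (b <ᵇ c) = refl

  starts312-below : (x : ℕ) (M : List ℕ) → All (x <_) M → starts312 x M ≡ 0
  starts312-below x [] _ = refl
  starts312-below x (b ∷ []) _ = refl
  starts312-below x (b ∷ c ∷ M) (_ ∷ x<c ∷ _) = pattern312-high x b (<⇒≤ x<c)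

  occ-++ : (A B : List ℕ) (c : ℕ) → All (_≤ c) A → All (c <_) B → occ312L (A ++ B) ≡ occ312L A + occ312L B
  occ-++ [] B c _ _ = refl
  occ-++ (a ∷ A) B c (a≤c ∷ A≤c) c<B = begin
    occ312L (a ∷ (A ++ B))                      ≡⟨ occ-cons a (A ++ B) ⟩
    starts312 a (A ++ B) + occ312L (A ++ B)     ≡⟨ cong₂ _+_ (window A A≤c B c<B) (occ-++ A B c A≤c c<B) ⟩
    starts312 a A + (occ312L A + occ312L B)     ≡⟨ +-assoc (starts312 a A) _ _ ⟨
    (starts312 a A + occ312L A) + occ312L B     ≡⟨ cong (_+ occ312L B) (occ-cons a A) ⟨
    occ312L (a ∷ A) + occ312L B                 ∎
    where
    open ≡-Reasoning
    window : (A : List ℕ) → All (_≤ c) A → (B : List ℕ) → All (c <_) B → starts312 a (A ++ B) ≡ starts312 a A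
    window [] _ [] _ = refl
    window [] _ (b ∷ []) _ = refl
    window [] _ (b₁ ∷ b₂ ∷ B) (_ ∷ c<b₂ ∷ _) = pattern312-high a b₁ (≤-trans a≤c (<⇒≤ c<b₂))
    window (a′ ∷ []) _ [] _ = refl
    window (a′ ∷ []) _ (b ∷ B) (c<b ∷ _) = pattern312-high a a′ (≤-trans a≤c (<⇒≤ c<b))
    window (a′ ∷ a″ ∷ A) _ B _ = refl

  occ-snoc-smallest : (S : List ℕ) (y : ℕ) → All (y <_) S → occ312L (S ++ [ y ]) ≡ occ312L S
  occ-snoc-smallest [] y _ = refl
  occ-snoc-smallest (s ∷ S) y (_ ∷ y<S) =
    trans (occ-cons s (S ++ [ y ])) (trans (cong₂ _+_ (window S y<S) (occ-snoc-smallest S y y<S)) (sym (occ-cons s S)))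
    where
    window : (S : List ℕ) → All (y <_) S → starts312 s (S ++ [ y ]) ≡ starts312 s S
    window [] _ = refl
    window (s′ ∷ []) (y<s′ ∷ _) = pattern312-descent s s′ (<⇒≤ y<s′)
    window (s′ ∷ s″ ∷ S) _ = refl

  arc-opener-312 : ∀ o s → starts312 (suc (o + size s)) (encode (suc o) s ++ [ o ]) ≡ arc312 s
  arc-opener-312 o leaf = refl
  arc-opener-312 o (fixed leaf) = pattern312-descent (suc (o + 1)) (suc o) (n≤1+n o)
  arc-opener-312 o (fixed s@(fixed _)) = pattern312-holds (suc (o + size (fixed s))) (suc o)
    (All.head (encode-above (suc (suc o)) s)) (All.head (All.tail (encode-below (suc o) (fixed s))))
  arc-opener-312 o (fixed s@(arc _ _)) = pattern312-holds (suc (o + size (fixed s))) (suc o)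
    (All.head (encode-above (suc (suc o)) s)) (All.head (All.tail (encode-below (suc o) (fixed s))))
  arc-opener-312 o (arc leaf r) = pattern312-descent (suc (o + size (arc leaf r))) (suc (suc (o + 0)))
    (≤-trans (n≤1+n (suc o)) (s≤s (s≤s (m≤m+n o 0))))
  arc-opener-312 o (arc s@(fixed _) r) = pattern312-descent (suc (o + size (arc s r))) (suc (suc (o + size s)))
    (<⇒≤ (All.head (encode-below (suc (suc o)) s)))
  arc-opener-312 o (arc s@(arc _ _) r) = pattern312-descent (suc (o + size (arc s r))) (suc (suc (o + size s)))
    (<⇒≤ (All.head (encode-below (suc (suc o)) s)))

  occ-encode : ∀ o t → occ312L (encode o t) ≡ occT t
  occ-encode o leaf = refl
  occ-encode o (fixed s) =
    trans (occ-cons o (encode (suc o) s)) (cong₂ _+_ (starts312-below o _ (encode-above (suc o) s)) (occ-encode (suc o) s))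
  occ-encode o (arc s r) = begin
    occ312L (x ∷ (S ++ (o ∷ R)))                             ≡⟨ cong (λ L → occ312L (x ∷ L)) (++-assoc S [ o ] R) ⟨
    occ312L ((x ∷ (S ++ [ o ])) ++ R)                        ≡⟨ occ-++ (x ∷ (S ++ [ o ])) R x head≤x (encode-above (suc x) r) ⟩
    occ312L (x ∷ (S ++ [ o ])) + occ312L R                   ≡⟨ cong (_+ occ312L R) (occ-cons x (S ++ [ o ])) ⟩
    (starts312 x (S ++ [ o ]) + occ312L (S ++ [ o ])) + occ312L R
      ≡⟨ cong₂ _+_ (cong₂ _+_ (arc-opener-312 o s) (trans (occ-snoc-smallest S o (encode-above (suc o) s)) (occ-encode (suc o) s)))
                   (occ-encode (suc x) r) ⟩
    (arc312 s + occT s) + occT r                             ∎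
    where
    open ≡-Reasoning
    x = suc (o + size s)
    S = encode (suc o) s
    R = encode (suc x) r
    head≤x : All (_≤ x) (x ∷ (S ++ [ o ]))
    head≤x = ≤-refl ∷ ++⁺ (All.map <⇒≤ (encode-below (suc o) s)) (≤-trans (n≤1+n o) (s≤s (m≤m+n o (size s))) ∷ [])

  ≡ᵇ-false : ∀ {a b} → a ≢ b → (a ≡ᵇ b) ≡ false
  ≡ᵇ-false {a} {b} a≢b with a ≡ᵇ b in eq
  ... | true = ⊥-elim (a≢b (≡ᵇ⇒≡ a b (from T-≡ eq)))
  ... | false = refl

  ≡ᵇ-refl : ∀ a → (a ≡ᵇ a) ≡ true
  ≡ᵇ-refl a = to T-≡ (≡⇒≡ᵇ a a refl)

  fixFrom-++ : ∀ o A B → fixFrom o (A ++ B) ≡ fixFrom o A + fixFrom (o + length A) B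
  fixFrom-++ o [] B = cong (λ o′ → fixFrom o′ B) (sym (+-identityʳ o))
  fixFrom-++ o (x ∷ A) B with x ≡ᵇ o
  ... | true = cong suc (trans (fixFrom-++ (suc o) A B) (cong (λ o′ → fixFrom (suc o) A + fixFrom o′ B) (sym (+-suc o (length A)))))
  ... | false = trans (fixFrom-++ (suc o) A B) (cong (λ o′ → fixFrom (suc o) A + fixFrom o′ B) (sym (+-suc o (length A))))

  fix-encode : ∀ o t → fixFrom o (encode o t) ≡ fixT t
  fix-encode o leaf = refl
  fix-encode o (fixed s) rewrite ≡ᵇ-refl o = cong suc (fix-encode (suc o) s)
  fix-encode o (arc s r) rewrite ≡ᵇ-false (<⇒≢ (s≤s (m≤m+n o (size s))) ∘ sym) = begin
    fixFrom (suc o) (S ++ (o ∷ R))                         ≡⟨ fixFrom-++ (suc o) S (o ∷ R) ⟩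
    fixFrom (suc o) S + fixFrom (suc o + length S) (o ∷ R) ≡⟨ cong (λ m → fixFrom (suc o) S + fixFrom (suc o + m) (o ∷ R)) (length-encode (suc o) s) ⟩
    fixFrom (suc o) S + fixFrom x (o ∷ R)                  ≡⟨ cong (fixFrom (suc o) S +_) skip-closer ⟩
    fixFrom (suc o) S + fixFrom (suc x) R                  ≡⟨ cong₂ _+_ (fix-encode (suc o) s) (fix-encode (suc x) r) ⟩
    fixT s + fixT r                                        ∎
    where
    open ≡-Reasoning
    x = suc (o + size s)
    S = encode (suc o) s
    R = encode (suc x) r
    o<x : o < x
    o<x = s≤s (m≤m+n o (size s))
    skip-closer : fixFrom x (o ∷ R) ≡ fixFrom (suc x) R
    skip-closer rewrite ≡ᵇ-false (<⇒≢ o<x) = refl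

  encode-injective : ∀ o t t′ → encode o t ≡ encode o t′ → t ≡ t′
  encode-injective o leaf leaf e = refl
  encode-injective o (fixed s) (fixed s′) e = cong fixed (encode-injective (suc o) s s′ (proj₂ (∷-injective e)))
  encode-injective o (fixed s) (arc s′ r′) e = ⊥-elim (<-irrefl (proj₁ (∷-injective e)) (s≤s (m≤m+n o (size s′))))
  encode-injective o (arc s r) (fixed s′) e = ⊥-elim (<-irrefl (sym (proj₁ (∷-injective e))) (s≤s (m≤m+n o (size s))))
  encode-injective o (arc s r) (arc s′ r′) e with ∷-injective e
  ... | e₁ , e₂ with ++-cancel (encode (suc o) s) (encode (suc o) s′) _ _ same-length e₂
    where
    same-length : length (encode (suc o) s) ≡ length (encode (suc o) s′)
    same-length = trans (length-encode (suc o) s) (trans (+-cancelˡ-≡ o _ _ (suc-injective e₁)) (sym (length-encode (suc o) s′)))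
  ... | e₃ , e₄ with encode-injective (suc o) s s′ e₃
  ... | refl = cong (arc s) (encode-injective _ r r′ (proj₂ (∷-injective e₄)))

  3412-cons : (x : ℕ) (M : List ℕ) → Has3412 M → Has3412 (x ∷ M)
  3412-cons x M (occurrence i j k l i<j j<k k<l l<M vkl vli vij) =
    occurrence (suc i) (suc j) (suc k) (suc l) (s<s i<j) (s<s j<k) (s<s k<l) (s<s l<M) vkl vli vij

  3412-prefix : (A B : List ℕ) → Has3412 A → Has3412 (A ++ B)
  3412-prefix A B (occurrence i j k l i<j j<k k<l l<A vkl vli vij) =
    occurrence i j k l i<j j<k k<l (<-≤-trans l<A (subst (length A ≤_) (sym (length-++ A)) (m≤m+n _ _)))
      (subst₂ _<_ (e k<A) (e l<A) vkl) (subst₂ _<_ (e l<A) (e i<A) vli) (subst₂ _<_ (e i<A) (e j<A) vij)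
    where
    k<A = <-trans k<l l<A
    j<A = <-trans j<k k<A
    i<A = <-trans i<j j<A
    e : ∀ {x} → x < length A → at A x ≡ at (A ++ B) x
    e x<A = sym (at-++ˡ A B x<A)

  3412-suffix : (A B : List ℕ) → Has3412 B → Has3412 (A ++ B)
  3412-suffix [] B h = h
  3412-suffix (x ∷ A) B h = 3412-cons x (A ++ B) (3412-suffix A B h)

  module ArcDecomposition (o : ℕ) (S R : List ℕ)
      (inv : InvolutionFrom o (o + suc (length S) ∷ (S ++ (o ∷ R))))
      (avoid : ¬ Has3412 (o + suc (length S) ∷ (S ++ (o ∷ R)))) where

    open ArcShape (o + suc (length S)) o S R
    m = length S

    inner-involution : InvolutionFrom (suc o) S
    inner-involution p p<m with inv (suc p) (inner<L p<m)
    ... | j , j<L , e₁ , e₂ with position j j<L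
    ... | opener = ⊥-elim (<-irrefl (sym (suc-injective (+-cancelˡ-≡ o _ _ e₂))) p<m)
    ... | closer = ⊥-elim (0≢1+n (+-cancelˡ-≡ o _ _ (trans (+-identityʳ o) (trans (sym at-closer) e₂))))
    ... | inner j′ j′<m = j′ , j′<m , trans (sym (at-inner p<m)) (trans e₁ (+-suc o j′)) ,
                                      trans (sym (at-inner j′<m)) (trans e₂ (+-suc o p))
    -- an inner entry paired with a position after the closer forms a 3412
    -- together with the opener and the closer
    ... | after q q<r = ⊥-elim (avoid (occurrence 0 (suc p) (suc m) (suc (suc (m + q)))
            z<s (s<s p<m) (s<s (s≤s (m≤m+n m q))) j<L
            (subst₂ _<_ (sym at-closer) (sym e₂) (m<m+n o z<s))
            (subst (_< o + suc m) (sym e₂) (+-monoʳ-< o (s<s p<m)))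
            (subst (o + suc m <_) (sym e₁) (+-monoʳ-< o (s<s (s<s (m≤m+n m q)))))))

    remainder-involution : InvolutionFrom (suc (suc (o + m))) R
    remainder-involution q q<r with inv (suc (suc (m + q))) (after<L q<r)
    ... | j , j<L , e₁ , e₂ with position j j<L
    ... | opener = ⊥-elim (<-irrefl (suc-injective (+-cancelˡ-≡ o _ _ e₂)) (s≤s (m≤m+n m q)))
    ... | closer = ⊥-elim (0≢1+n (+-cancelˡ-≡ o _ _ (trans (+-identityʳ o) (trans (sym at-closer) e₂))))
    -- the inner block only holds values below o + |S| + 1
    ... | inner p p<m = ⊥-elim (<-asym (All⇒at S-below p<m) above)
      where
      S-below : All (_< suc o + m) S
      S-below = All.map proj₂ (involution-range inner-involution)
      above : suc o + m < at S p
      above = subst (suc o + m <_) (trans (sym (after-offset o m q)) (trans (sym e₂) (at-inner p<m)))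
                (m≤m+n (suc (suc (o + m))) q)
    ... | after q′ q′<r = q′ , q′<r , trans (sym (at-after q)) (trans e₁ (after-offset o m q′)) ,
                                      trans (sym (at-after q′)) (trans e₂ (after-offset o m q))

    inner-avoids : ¬ Has3412 S
    inner-avoids h = avoid (3412-cons _ _ (3412-prefix S (o ∷ R) h))

    remainder-avoids : ¬ Has3412 R
    remainder-avoids h = avoid (3412-cons _ _ (3412-suffix S (o ∷ R) (3412-cons o R h)))

  fixed-tail-involution : ∀ o L → InvolutionFrom o (o ∷ L) → InvolutionFrom (suc o) L
  fixed-tail-involution o L inv i i<L with inv (suc i) (s<s i<L)
  ... | zero , _ , _ , e₂ = ⊥-elim (<-irrefl (trans e₂ (+-suc o i)) (s≤s (m≤m+n o i)))
  ... | suc j , s<s j<L , e₁ , e₂ = j , j<L , trans e₁ (+-suc o j) , trans e₂ (+-suc o i)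

  encode-arc : ∀ o s r → encode o (arc s r) ≡
    o + suc (length (encode (suc o) s)) ∷ (encode (suc o) s ++ (o ∷ encode (suc (suc (o + length (encode (suc o) s)))) r))
  encode-arc o s r rewrite length-encode (suc o) s =
    cong (_∷ (encode (suc o) s ++ (o ∷ encode (suc (suc (o + size s))) r))) (sym (+-suc o (size s)))

  decode : ∀ b o L → length L < b → InvolutionFrom o L → ¬ Has3412 L → ∃[ t ] encode o t ≡ L
  decode (suc b) o [] _ _ _ = leaf , refl
  decode (suc b) o (x ∷ L) (s<s L<b) inv avoid with inv 0 z<s
  ... | zero , _ , x≡o+0 , _ with trans x≡o+0 (+-identityʳ o)
  ... | refl with decode b (suc o) L L<b (fixed-tail-involution o L inv) (avoid ∘ 3412-cons o L)
  ... | t , refl = fixed t , refl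
  decode (suc b) o (x ∷ L) (s<s L<b) inv avoid | suc m , m<L , x≡ , Lm≡ with split-at L (s<s⁻¹ m<L) (trans Lm≡ (+-identityʳ o))
  ... | S , R , refl , refl with x≡
  ... | refl with decode b (suc o) S S<b inner-involution inner-avoids | decode b _ R R<b remainder-involution remainder-avoids
    where
    open ArcDecomposition o S R inv avoid
    S<b : length S < b
    S<b = ≤-<-trans (subst (length S ≤_) (sym (length-++ S)) (m≤m+n _ _)) L<b
    R<b : length R < b
    R<b = ≤-<-trans (subst (length R ≤_) (sym (length-++ S)) (≤-trans (n≤1+n (length R)) (m≤n+m _ (length S)))) L<b
  ... | s , refl | r , refl = arc s r , encode-arc o s r

  -- Enumeration of trees by size.  arcs T m lists the arcs of size m + 1 whose
  -- blocks are drawn from the lists T a; treesWithFuel f n lists the trees of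
  -- size n, the fuel f > n only making the recursion structural.
  arcs : (ℕ → List Tree) → ℕ → List Tree
  arcs T zero = []
  arcs T (suc m) = concatMap (λ a → cartesianProductWith arc (T a) (T (m ∸ a))) (upTo (suc m))

  treesWithFuel : ℕ → ℕ → List Tree
  treesWithFuel zero n = []
  treesWithFuel (suc f) zero = leaf ∷ []
  treesWithFuel (suc f) (suc n) = map fixed (treesWithFuel f n) ++ arcs (treesWithFuel f) n

  trees : ℕ → List Tree
  trees n = treesWithFuel (suc n) n

  ∈-arcs : ∀ T m {t} → t ∈ arcs T m → ∃[ a ] a < m × ∃[ s ] ∃[ r ] s ∈ T a × r ∈ T (m ∸ suc a) × t ≡ arc s r
  ∈-arcs T (suc m) t∈ with ∈-concatMap-split _ {xs = upTo (suc m)} t∈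
  ... | a , a∈ , t∈′ with ∈-cartesianProductWith⁻ arc (T a) (T (m ∸ a)) t∈′
  ... | s , r , s∈ , r∈ , refl = a , ∈-upTo⁻ a∈ , s , r , s∈ , r∈ , refl

  size-of-member : ∀ f n {t} → t ∈ treesWithFuel f n → size t ≡ n
  size-of-member (suc f) zero (here refl) = refl
  size-of-member (suc f) (suc n) t∈ with ∈-++⁻ (map fixed (treesWithFuel f n)) t∈
  ... | inj₁ t∈fixed with ∈-map⁻ fixed t∈fixed
  ...   | s , s∈ , refl = cong suc (size-of-member f n s∈)
  size-of-member (suc f) (suc n) t∈ | inj₂ t∈arcs with ∈-arcs (treesWithFuel f) n t∈arcs
  ... | a , a<n , s , r , s∈ , r∈ , refl =
    cong suc (trans (cong suc (cong₂ _+_ (size-of-member f a s∈) (size-of-member f (n ∸ suc a) r∈))) (m+[n∸m]≡n a<n))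

  member-of-size : ∀ f t → size t < f → t ∈ treesWithFuel f (size t)
  member-of-size (suc f) leaf _ = here refl
  member-of-size (suc f) (fixed s) (s<s s<f) = ∈-++⁺ˡ (∈-map⁺ fixed (member-of-size f s s<f))
  member-of-size (suc f) (arc s r) (s<s t<f) = ∈-++⁺ʳ (map fixed (treesWithFuel f (suc (size s + size r))))
    (∈-concatMap-join _ (∈-upTo⁺ (s≤s (m≤m+n (size s) (size r))))
      (∈-cartesianProductWith⁺ arc (member-of-size f s s<f)
        (subst (λ n → r ∈ treesWithFuel f n) (sym (m+n∸m≡n (size s) (size r))) (member-of-size f r r<f))))
    where
    s<f : size s < f
    s<f = ≤-<-trans (m≤m+n (size s) (size r)) (<-trans (n<1+n _) t<f)
    r<f : size r < f
    r<f = ≤-<-trans (m≤n+m (size r) (size s)) (<-trans (n<1+n _) t<f)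

  trees-unique : ∀ f n → Unique (treesWithFuel f n)
  trees-unique zero n = []
  trees-unique (suc f) zero = [] ∷ []
  trees-unique (suc f) (suc n) = Unique.++⁺ (Unique.map⁺ fixed-injective (trees-unique f n)) (arcs-unique n) fixed≢arc
    where
    fixed-injective : ∀ {s s′} → fixed s ≡ fixed s′ → s ≡ s′
    fixed-injective refl = refl
    arc-injective : ∀ {s s′ r r′} → arc s r ≡ arc s′ r′ → s ≡ s′ × r ≡ r′
    arc-injective refl = refl , refl
    fixed≢arc : ∀ {t} → ¬ (t ∈ map fixed (treesWithFuel f n) × t ∈ arcs (treesWithFuel f) n)
    fixed≢arc (t∈fixed , t∈arcs) with ∈-map⁻ fixed t∈fixed | ∈-arcs (treesWithFuel f) n t∈arcs
    ... | _ , _ , refl | _ , _ , _ , _ , _ , _ , ()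
    arcs-unique : ∀ n → Unique (arcs (treesWithFuel f) n)
    arcs-unique zero = []
    arcs-unique (suc m) = unique-concatMap _ (Unique.upTo⁺ (suc m))
      (λ {a} _ → Unique.cartesianProductWith⁺ arc arc-injective (trees-unique f a) (trees-unique f (m ∸ a)))
      same-block
      where
      same-block : ∀ {a a′ t} → t ∈ cartesianProductWith arc (treesWithFuel f a) (treesWithFuel f (m ∸ a)) →
        t ∈ cartesianProductWith arc (treesWithFuel f a′) (treesWithFuel f (m ∸ a′)) → a ≡ a′
      same-block {a} {a′} t∈ t∈′ with ∈-cartesianProductWith⁻ arc (treesWithFuel f a) _ t∈
                                    | ∈-cartesianProductWith⁻ arc (treesWithFuel f a′) _ t∈′
      ... | s , _ , s∈ , _ , refl | _ , _ , s∈′ , _ , refl = trans (sym (size-of-member f a s∈)) (size-of-member f a′ s∈′)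

  count-fuel : (p : Tree → Bool) → ∀ f a → a < f → countB p (treesWithFuel f a) ≡ countB p (trees a)
  count-fuel p f a a<f = count-by-codes p p (λ t → t) (λ t → t) (λ e → e) (λ e → e) (trees-unique f a) (trees-unique (suc a) a)
    (λ {t} t∈ pt → t , resize (suc a) {f} t∈ ≤-refl , pt , refl)
    (λ {t} t∈ pt → t , resize f {suc a} t∈ a<f , pt , refl)
    where
    resize : ∀ f′ {f t} → t ∈ treesWithFuel f a → a < f′ → t ∈ treesWithFuel f′ a
    resize f′ {f} {t} t∈ a<f′ = subst (λ n → t ∈ treesWithFuel f′ n) (size-of-member f a t∈)
      (member-of-size f′ t (subst (_< f′) (sym (size-of-member f a t∈)) a<f′))

  T-not⁺ : ∀ {b} → ¬ T b → T (not b)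
  T-not⁺ {true} ¬b = ¬b _
  T-not⁺ {false} _ = _

  T-not⁻ : ∀ {b} → T (not b) → ¬ T b
  T-not⁻ {true} ()
  T-not⁻ {false} _ ()

  withStats : (Tree → ℕ) → ℕ → ℕ → Tree → Bool
  withStats u k j t = (u t ≡ᵇ k) ∧ (fixT t ≡ᵇ j)

  coeffF≡tree-count : ∀ n k j → coeffF n k j ≡ countB (withStats occT k j) (trees n)
  coeffF≡tree-count n k j = count-by-codes _ (withStats occT k j) values (encode 0)
    values-injective (λ {t} {t′} → encode-injective 0 t t′) (words-unique n n) (trees-unique (suc n) n)
    involution→tree tree→involution
    where
    involution→tree : ∀ {v} → v ∈ words n n →
      T (isInvolution v ∧ not (contains3412 v) ∧ (occ312 v ≡ᵇ k) ∧ (fix v ≡ᵇ j)) →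
      ∃[ t ] t ∈ trees n × T (withStats occT k j t) × encode 0 t ≡ values v
    involution→tree {v} _ good with to T-∧ good
    ... | inv , good′ with to T-∧ good′
    ... | avoid , stats with to T-∧ stats
    ... | occ≡k , fix≡j with decode (suc (length (values v))) 0 (values v) ≤-refl (involution⇒ v inv)
                                     (T-not⁻ avoid ∘ contains3412⇐ v)
    ... | t , t↦v = t , t∈ , from T-∧ (≡⇒≡ᵇ _ _ occT≡k , ≡⇒≡ᵇ _ _ fixT≡j) , t↦v
      where
      size≡n : size t ≡ n
      size≡n = trans (sym (length-encode 0 t)) (trans (cong length t↦v) (length-values v))
      t∈ : t ∈ trees n
      t∈ = subst (λ m → t ∈ treesWithFuel (suc n) m) size≡n (member-of-size (suc n) t (s≤s (≤-reflexive size≡n)))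
      occT≡k : occT t ≡ k
      occT≡k = trans (sym (occ-encode 0 t)) (trans (cong occ312L t↦v) (≡ᵇ⇒≡ _ _ occ≡k))
      fixT≡j : fixT t ≡ j
      fixT≡j = trans (sym (fix-encode 0 t)) (trans (cong (fixFrom 0) t↦v) (trans (sym (fix-values v)) (≡ᵇ⇒≡ _ _ fix≡j)))
    tree→involution : ∀ {t} → t ∈ trees n → T (withStats occT k j t) →
      ∃[ v ] v ∈ words n n × T (isInvolution v ∧ not (contains3412 v) ∧ (occ312 v ≡ᵇ k) ∧ (fix v ≡ᵇ j)) × values v ≡ encode 0 t
    tree→involution {t} t∈ stats with to T-∧ stats
    ... | occ≡k , fix≡j with from-values n n (encode 0 t) (trans (length-encode 0 t) size≡n)
                               (All.map (λ {x} x< → subst (x <_) size≡n x<) (encode-below 0 t))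
      where
      size≡n : size t ≡ n
      size≡n = size-of-member (suc n) n t∈
    ... | v , v↦t = v , words-complete n n v ,
      from T-∧ (involution⇐ v (subst (InvolutionFrom 0) (sym v↦t) (encode-involution 0 t)) ,
      from T-∧ (T-not⁺ (encode-avoids-3412 0 t ∘ subst Has3412 v↦t ∘ contains3412⇒ v) ,
      from T-∧ (≡⇒≡ᵇ _ _ (trans (cong occ312L v↦t) (trans (occ-encode 0 t) (≡ᵇ⇒≡ _ _ occ≡k))) ,
                ≡⇒≡ᵇ _ _ (trans (fix-values v) (trans (cong (fixFrom 0) v↦t) (trans (fix-encode 0 t) (≡ᵇ⇒≡ _ _ fix≡j))))))) ,
      v↦t

module GeneratingFunction where

  open import Data.Bool using (Bool; true; false; _∧_; if_then_else_)
  open import Data.Bool.Properties using (∧-zeroʳ)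
  open import Data.Integer using (ℤ; +_; _+_; _*_; -_; _-_; 0ℤ; 1ℤ)
  open import Data.Integer.Properties using (+-assoc; +-identityˡ; +-identityʳ; *-identityˡ; *-zeroˡ; *-zeroʳ;
    *-distribʳ-+; neg-distrib-+; neg-distribˡ-*; pos-+)
  open import Data.Integer.Tactic.RingSolver using (solve-∀)
  open import Data.List using (List; []; _∷_; _++_; map; concatMap; applyUpTo; upTo; cartesianProductWith)
  open import Data.List.Membership.Propositional using (_∈_)
  open import Data.Nat using (ℕ; zero; suc; _∸_; _≤_; _≡ᵇ_; _<ᵇ_; z≤n; s≤s)
  import Data.Nat as ℕ
  open import Data.Nat.Properties using (m≤n⇒m≤1+n; ≤-refl; m∸n≤m)
  open import Data.Product using (_,_)
  open import Relation.Binary.PropositionalEquality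
  open Combinatorics using (Tree; leaf; fixed; arc; occT; fixT; arc312; trees; treesWithFuel; arcs;
    countB-++; countB-map; countB-cong; countB-none; count-fuel; size-of-member; ∈-arcs; withStats; coeffF≡tree-count)

  sumTo-cong : ∀ n {f g : ℕ → ℤ} → (∀ a → a ≤ n → f a ≡ g a) → sumTo n f ≡ sumTo n g
  sumTo-cong zero e = e 0 z≤n
  sumTo-cong (suc n) e = cong₂ _+_ (sumTo-cong n (λ a a≤n → e a (m≤n⇒m≤1+n a≤n))) (e (suc n) ≤-refl)

  sumTo-cong′ : ∀ n {f g : ℕ → ℤ} → (∀ a → f a ≡ g a) → sumTo n f ≡ sumTo n g
  sumTo-cong′ n e = sumTo-cong n (λ a _ → e a)

  sumTo-zero : ∀ n → sumTo n (λ _ → 0ℤ) ≡ 0ℤ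
  sumTo-zero zero = refl
  sumTo-zero (suc n) = cong (_+ 0ℤ) (sumTo-zero n)

  sumTo-+ : ∀ n (f g : ℕ → ℤ) → sumTo n (λ a → f a + g a) ≡ sumTo n f + sumTo n g
  sumTo-+ zero f g = refl
  sumTo-+ (suc n) f g = trans (cong (_+ (f (suc n) + g (suc n))) (sumTo-+ n f g)) (interchange (sumTo n f) (sumTo n g) (f (suc n)) (g (suc n)))
    where
    interchange : ∀ a b c d → (a + b) + (c + d) ≡ (a + c) + (b + d)
    interchange = solve-∀

  sumTo-neg : ∀ n (f : ℕ → ℤ) → sumTo n (λ a → - f a) ≡ - sumTo n f
  sumTo-neg zero f = refl
  sumTo-neg (suc n) f = trans (cong (_+ (- f (suc n))) (sumTo-neg n f)) (sym (neg-distrib-+ (sumTo n f) (f (suc n))))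

  sumTo-- : ∀ n (f g : ℕ → ℤ) → sumTo n (λ a → f a - g a) ≡ sumTo n f - sumTo n g
  sumTo-- n f g = trans (sumTo-+ n f (λ a → - g a)) (cong (_+_ (sumTo n f)) (sumTo-neg n g))

  sumTo-head : ∀ n (f : ℕ → ℤ) → sumTo (suc n) f ≡ f 0 + sumTo n (λ a → f (suc a))
  sumTo-head zero f = refl
  sumTo-head (suc n) f = trans (cong (_+ f (suc (suc n))) (sumTo-head n f)) (+-assoc (f 0) _ _)

  sumTo-drop-first : ∀ m (g Z : ℕ → ℤ) → g 0 ≡ 0ℤ → (∀ a → g (suc a) ≡ Z (suc a)) → sumTo m g ≡ sumTo m Z - Z 0
  sumTo-drop-first zero g Z g0 _ = trans g0 (sym (cancel (Z 0)))
    where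
    cancel : ∀ z → z - z ≡ 0ℤ
    cancel = solve-∀
  sumTo-drop-first (suc m) g Z g0 gs = begin
    sumTo (suc m) g                               ≡⟨ sumTo-head m g ⟩
    g 0 + sumTo m (λ a → g (suc a))               ≡⟨ cong₂ _+_ g0 (sumTo-cong′ m gs) ⟩
    0ℤ + sumTo m (λ a → Z (suc a))                ≡⟨ reassociate (Z 0) _ ⟩
    (Z 0 + sumTo m (λ a → Z (suc a))) - Z 0      ≡⟨ cong (_- Z 0) (sumTo-head m Z) ⟨
    sumTo (suc m) Z - Z 0                         ∎
    where
    open ≡-Reasoning
    reassociate : ∀ z s → 0ℤ + s ≡ (z + s) - z
    reassociate = solve-∀

  sumTo-point : ∀ n u (X : ℕ → ℤ) → sumTo n (λ a → if a ≡ᵇ u then X a else 0ℤ) ≡ (if u <ᵇ suc n then X u else 0ℤ)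
  sumTo-point zero zero X = refl
  sumTo-point zero (suc u) X = refl
  sumTo-point (suc n) u X = trans (sumTo-head n _) (split u)
    where
    split : ∀ u → (if 0 ≡ᵇ u then X 0 else 0ℤ) + sumTo n (λ a → if suc a ≡ᵇ u then X (suc a) else 0ℤ)
                  ≡ (if u <ᵇ suc (suc n) then X u else 0ℤ)
    split zero = trans (cong (_+_ (X 0)) (sumTo-zero n)) (+-identityʳ (X 0))
    split (suc u) = trans (+-identityˡ _) (sumTo-point n u (λ a → X (suc a)))

  sumL : {A : Set} → (A → ℤ) → List A → ℤ
  sumL h [] = 0ℤ
  sumL h (x ∷ xs) = h x + sumL h xs

  sumL-applyUpTo : ∀ m (f : ℕ → ℕ) (h : ℕ → ℤ) → sumL h (applyUpTo f (suc m)) ≡ sumTo m (λ a → h (f a))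
  sumL-applyUpTo zero f h = +-identityʳ (h (f 0))
  sumL-applyUpTo (suc m) f h =
    trans (cong (_+_ (h (f 0))) (sumL-applyUpTo m (λ a → f (suc a)) h)) (sym (sumTo-head m (λ a → h (f a))))

  sumL-upTo : ∀ m (h : ℕ → ℤ) → sumL h (upTo (suc m)) ≡ sumTo m h
  sumL-upTo m h = sumL-applyUpTo m (λ a → a) h

  -- Shifts: shift e f n = f (n - e) for n ≥ e and 0 otherwise, i.e. the
  -- coefficients of a series multiplied by the e-th power of its variable.
  shift : ℕ → (ℕ → ℤ) → ℕ → ℤ
  shift zero f n = f n
  shift (suc e) f zero = 0ℤ
  shift (suc e) f (suc n) = shift e f n

  shift-cong : ∀ e {f g : ℕ → ℤ} n → (∀ m → f m ≡ g m) → shift e f n ≡ shift e g n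
  shift-cong zero n f≡g = f≡g n
  shift-cong (suc e) zero f≡g = refl
  shift-cong (suc e) (suc n) f≡g = shift-cong e n f≡g

  shift-- : ∀ e (f g : ℕ → ℤ) n → shift e (λ m → f m - g m) n ≡ shift e f n - shift e g n
  shift-- zero f g n = refl
  shift-- (suc e) f g zero = refl
  shift-- (suc e) f g (suc n) = shift-- e f g n

  shift-*ˡ : ∀ e (c : ℤ) (f : ℕ → ℤ) n → shift e (λ m → c * f m) n ≡ c * shift e f n
  shift-*ˡ zero c f n = refl
  shift-*ˡ (suc e) c f zero = sym (*-zeroʳ c)
  shift-*ˡ (suc e) c f (suc n) = shift-*ˡ e c f n

  shift-*ʳ : ∀ e (f : ℕ → ℤ) (y : ℤ) n → shift e f n * y ≡ shift e (λ m → f m * y) n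
  shift-*ʳ zero f y n = refl
  shift-*ʳ (suc e) f y zero = *-zeroˡ y
  shift-*ʳ (suc e) f y (suc n) = shift-*ʳ e f y n

  -- The shift in the form produced by picking out one summand of a product.
  shift-as-if : ∀ e (f : ℕ → ℤ) n → (if e <ᵇ suc n then f (n ∸ e) else 0ℤ) ≡ shift e f n
  shift-as-if zero f n = refl
  shift-as-if (suc e) f zero = refl
  shift-as-if (suc e) f (suc n) = shift-as-if e f n

  sumTo-shift : ∀ m e (f : ℕ → ℕ → ℤ) n → sumTo m (λ a → shift e (f a) n) ≡ shift e (λ n′ → sumTo m (λ a → f a n′)) n
  sumTo-shift m zero f n = refl
  sumTo-shift m (suc e) f zero = sumTo-zero m
  sumTo-shift m (suc e) f (suc n) = sumTo-shift m e f n

  convolution-shift : ∀ e (R : ℕ → ℕ → ℤ) k →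
    sumTo k (λ b → shift e (λ b′ → R b′ (k ∸ b)) b) ≡ shift e (λ k′ → sumTo k′ (λ b → R b (k′ ∸ b))) k
  convolution-shift zero R k = refl
  convolution-shift (suc e) R zero = refl
  convolution-shift (suc e) R (suc k) =
    trans (sumTo-head k _) (trans (+-identityˡ _) (convolution-shift e R k))

  Coeffs : Set
  Coeffs = ℕ → ℕ → ℤ

  conv2 : Coeffs → Coeffs → Coeffs
  conv2 P Q k j = sumTo k (λ b → sumTo j (λ c → P b c * Q (k ∸ b) (j ∸ c)))

  shift2 : ℕ → ℕ → Coeffs → Coeffs
  shift2 e₂ e₃ P k j = shift e₂ (λ k′ → shift e₃ (P k′) j) k

  conv2-congˡ : ∀ {P P′} (Q : Coeffs) k j → (∀ b c → P b c ≡ P′ b c) → conv2 P Q k j ≡ conv2 P′ Q k j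
  conv2-congˡ Q k j e = sumTo-cong′ k (λ b → sumTo-cong′ j (λ c → cong (_* Q (k ∸ b) (j ∸ c)) (e b c)))

  conv2-congʳ : ∀ (P : Coeffs) {Q Q′} k j → (∀ b c → Q b c ≡ Q′ b c) → conv2 P Q k j ≡ conv2 P Q′ k j
  conv2-congʳ P k j e = sumTo-cong′ k (λ b → sumTo-cong′ j (λ c → cong (P b c *_) (e (k ∸ b) (j ∸ c))))

  conv2-+ˡ : ∀ (P P′ Q : Coeffs) k j → conv2 (λ b c → P b c + P′ b c) Q k j ≡ conv2 P Q k j + conv2 P′ Q k j
  conv2-+ˡ P P′ Q k j = trans (sumTo-cong′ k (λ b → trans (sumTo-cong′ j (λ c → *-distribʳ-+ (Q (k ∸ b) (j ∸ c)) (P b c) (P′ b c)))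
    (sumTo-+ j _ _))) (sumTo-+ k _ _)

  conv2--ˡ : ∀ (P P′ Q : Coeffs) k j → conv2 (λ b c → P b c - P′ b c) Q k j ≡ conv2 P Q k j - conv2 P′ Q k j
  conv2--ˡ P P′ Q k j = trans (conv2-+ˡ P (λ b c → - P′ b c) Q k j) (cong (_+_ (conv2 P Q k j)) negate)
    where
    negate : conv2 (λ b c → - P′ b c) Q k j ≡ - conv2 P′ Q k j
    negate = trans (sumTo-cong′ k (λ b → trans (sumTo-cong′ j (λ c → sym (neg-distribˡ-* (P′ b c) _))) (sumTo-neg j _)))
                   (sumTo-neg k _)

  conv2-zeroˡ : ∀ (Q : Coeffs) k j → conv2 (λ _ _ → 0ℤ) Q k j ≡ 0ℤ
  conv2-zeroˡ Q k j = trans (sumTo-cong′ k (λ b → sumTo-zero j)) (sumTo-zero k)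

  conv2-shift : ∀ e₂ e₃ (P Q : Coeffs) k j → conv2 (shift2 e₂ e₃ P) Q k j ≡ shift2 e₂ e₃ (conv2 P Q) k j
  conv2-shift e₂ e₃ P Q k j = trans (shift-in-t e₂ (shift2 0 e₃ P) k) (shift-cong e₂ k (λ k′ → shift-in-z k′))
    where
    shift-in-z : ∀ k → conv2 (shift2 0 e₃ P) Q k j ≡ shift2 0 e₃ (conv2 P Q) k j
    shift-in-z k = trans (sumTo-cong′ k (λ b → trans (sumTo-cong′ j (λ c → shift-*ʳ e₃ (P b) _ c))
                                                      (convolution-shift e₃ (λ c c′ → P b c * Q (k ∸ b) c′) j)))
                         (sumTo-shift k e₃ (λ b j′ → sumTo j′ (λ c → P b c * Q (k ∸ b) (j′ ∸ c))) j)
    shift-in-t : ∀ e (P′ : Coeffs) k → conv2 (shift2 e 0 P′) Q k j ≡ shift2 e 0 (conv2 P′ Q) k j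
    shift-in-t e P′ k = trans (sumTo-cong′ k (λ b → trans (sumTo-cong′ j (λ c → shift-*ʳ e (λ b′ → P′ b′ c) _ b))
                                                          (sumTo-shift j e (λ c b′ → P′ b′ c * Q (k ∸ b) (j ∸ c)) b)))
                              (convolution-shift e (λ b′ k′ → sumTo j (λ c → P′ b′ c * Q k′ (j ∸ c))) k)

  point2 : ℕ → ℕ → Coeffs
  point2 u w b c = if (u ≡ᵇ b) ∧ (w ≡ᵇ c) then 1ℤ else 0ℤ

  ≡ᵇ-sym : ∀ a b → (a ≡ᵇ b) ≡ (b ≡ᵇ a)
  ≡ᵇ-sym zero zero = refl
  ≡ᵇ-sym zero (suc b) = refl
  ≡ᵇ-sym (suc a) zero = refl
  ≡ᵇ-sym (suc a) (suc b) = ≡ᵇ-sym a b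

  conv2-point : ∀ u w (Q : Coeffs) k j → conv2 (point2 u w) Q k j ≡ shift2 u w Q k j
  conv2-point u w Q k j = begin
    conv2 (point2 u w) Q k j
      ≡⟨ sumTo-cong′ k (λ b → row b) ⟩
    sumTo k (λ b → if b ≡ᵇ u then shift w (Q (k ∸ b)) j else 0ℤ)
      ≡⟨ sumTo-point k u (λ b → shift w (Q (k ∸ b)) j) ⟩
    (if u <ᵇ suc k then shift w (Q (k ∸ u)) j else 0ℤ)
      ≡⟨ shift-as-if u (λ k′ → shift w (Q k′) j) k ⟩
    shift2 u w Q k j ∎
    where
    open ≡-Reasoning
    entry : ∀ b c → point2 u w b c * Q (k ∸ b) (j ∸ c) ≡
                    (if b ≡ᵇ u then (if c ≡ᵇ w then Q (k ∸ b) (j ∸ c) else 0ℤ) else 0ℤ)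
    entry b c rewrite ≡ᵇ-sym u b | ≡ᵇ-sym w c with b ≡ᵇ u | c ≡ᵇ w
    ... | true | true = *-identityˡ _
    ... | true | false = refl
    ... | false | _ = refl
    row : ∀ b → sumTo j (λ c → point2 u w b c * Q (k ∸ b) (j ∸ c)) ≡ (if b ≡ᵇ u then shift w (Q (k ∸ b)) j else 0ℤ)
    row b = trans (sumTo-cong′ j (entry b)) (select (b ≡ᵇ u))
      where
      select : ∀ β → sumTo j (λ c → if β then (if c ≡ᵇ w then Q (k ∸ b) (j ∸ c) else 0ℤ) else 0ℤ) ≡
                     (if β then shift w (Q (k ∸ b)) j else 0ℤ)
      select true = trans (sumTo-point j w (λ c → Q (k ∸ b) (j ∸ c))) (shift-as-if w (Q (k ∸ b)) j)
      select false = sumTo-zero j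

  count : (Tree → ℕ) → List Tree → Coeffs
  count u T k j = + countB (withStats u k j) T

  count-++ : ∀ u A B k j → count u (A ++ B) k j ≡ count u A k j + count u B k j
  count-++ u A B k j = trans (cong +_ (countB-++ (withStats u k j) A B)) (pos-+ (countB (withStats u k j) A) _)

  count-cons : ∀ u s T k j → count u (s ∷ T) k j ≡ point2 (u s) (fixT s) k j + count u T k j
  count-cons u s T k j rewrite ≡ᵇ-sym (u s) k | ≡ᵇ-sym (fixT s) j with (k ≡ᵇ u s) ∧ (j ≡ᵇ fixT s)
  ... | true = pos-+ 1 _
  ... | false = sym (+-identityˡ _)

  count-raised : ∀ u w (f g : Tree → ℕ) (T : List Tree) k j →
    + countB (λ t → ((u ℕ.+ f t) ≡ᵇ k) ∧ ((w ℕ.+ g t) ≡ᵇ j)) T ≡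
    shift2 u w (λ k′ j′ → + countB (λ t → (f t ≡ᵇ k′) ∧ (g t ≡ᵇ j′)) T) k j
  count-raised zero zero f g T k j = refl
  count-raised zero (suc w) f g T k zero = cong +_ (countB-none _ T (λ {t} _ → ∧-zeroʳ (f t ≡ᵇ k)))
  count-raised zero (suc w) f g T k (suc j) = count-raised zero w f g T k j
  count-raised (suc u) w f g T zero j = cong +_ (countB-none _ T (λ _ → refl))
  count-raised (suc u) w f g T (suc k) j = count-raised u w f g T k j

  -- Counting the pairs (s, r) ↦ arc s r: the opener contributes arc312 s to occT.
  arcStat : Tree → ℕ
  arcStat s = arc312 s ℕ.+ occT s

  count-pairs : ∀ A B k j → count occT (cartesianProductWith arc A B) k j ≡ conv2 (count arcStat A) (count occT B) k j
  count-pairs [] B k j = sym (conv2-zeroˡ (count occT B) k j)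
  count-pairs (s ∷ A) B k j = begin
    count occT (map (arc s) B ++ cartesianProductWith arc A B) k j
      ≡⟨ count-++ occT (map (arc s) B) _ k j ⟩
    count occT (map (arc s) B) k j + count occT (cartesianProductWith arc A B) k j
      ≡⟨ cong₂ _+_ (trans (cong +_ (countB-map _ (arc s) B)) (count-raised (arcStat s) (fixT s) occT fixT B k j))
                   (count-pairs A B k j) ⟩
    shift2 (arcStat s) (fixT s) (count occT B) k j + conv2 (count arcStat A) (count occT B) k j
      ≡⟨ cong (_+ conv2 (count arcStat A) (count occT B) k j) (conv2-point (arcStat s) (fixT s) (count occT B) k j) ⟨
    conv2 (point2 (arcStat s) (fixT s)) (count occT B) k j + conv2 (count arcStat A) (count occT B) k j
      ≡⟨ conv2-+ˡ (point2 (arcStat s) (fixT s)) (count arcStat A) (count occT B) k j ⟨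
    conv2 (λ b c → point2 (arcStat s) (fixT s) b c + count arcStat A b c) (count occT B) k j
      ≡⟨ conv2-congˡ (count occT B) k j (λ b c → sym (count-cons arcStat s A b c)) ⟩
    conv2 (count arcStat (s ∷ A)) (count occT B) k j ∎
    where open ≡-Reasoning

  count-concatMap : ∀ u (g : ℕ → List Tree) m k j →
    count u (concatMap g (upTo (suc m))) k j ≡ sumTo m (λ a → count u (g a) k j)
  count-concatMap u g m k j = trans (over-list (upTo (suc m))) (sumL-upTo m (λ a → count u (g a) k j))
    where
    over-list : ∀ as → count u (concatMap g as) k j ≡ sumL (λ a → count u (g a) k j) as
    over-list [] = refl
    over-list (a ∷ as) = trans (count-++ u (g a) (concatMap g as) k j) (cong (_+_ (count u (g a) k j)) (over-list as))

  -- F n k j counts the trees of size n with occT = k and fixT = j; P n counts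
  -- them by (arcStat, fixT), the weight a tree receives inside an arc.
  F : Series
  F n = count occT (trees n)

  P : ℕ → Coeffs
  P n = count arcStat (trees n)

  count-fixed : ∀ T k j → count occT (map fixed T) k j ≡ shift2 0 1 (count occT T) k j
  count-fixed T k j = trans (cong +_ (countB-map _ fixed T)) (count-raised 0 1 occT fixT T k j)

  arcTerm : ℕ → Coeffs
  arcTerm zero k j = 0ℤ
  arcTerm (suc m) k j = sumTo m (λ a → conv2 (P a) (F (m ∸ a)) k j)

  count-arcs : ∀ n k j → count occT (arcs (treesWithFuel (suc n)) n) k j ≡ arcTerm n k j
  count-arcs zero k j = refl
  count-arcs (suc m) k j = trans (count-concatMap occT pairs m k j) (sumTo-cong m (λ a a≤m → trans
    (count-pairs (T a) (T (m ∸ a)) k j)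
    (trans (conv2-congˡ (count occT (T (m ∸ a))) k j
             (λ b c → cong +_ (count-fuel (withStats arcStat b c) (2 ℕ.+ m) a (s≤s (m≤n⇒m≤1+n a≤m)))))
           (conv2-congʳ (P a) k j
             (λ b c → cong +_ (count-fuel (withStats occT b c) (2 ℕ.+ m) (m ∸ a) (s≤s (m≤n⇒m≤1+n (m∸n≤m m a)))))))))
    where
    T = treesWithFuel (2 ℕ.+ m)
    pairs : ℕ → List Tree
    pairs a = cartesianProductWith arc (T a) (T (m ∸ a))

  F-suc : ∀ n k j → F (suc n) k j ≡ shift2 0 1 (F n) k j + arcTerm n k j
  F-suc n k j = trans (count-++ occT (map fixed (trees n)) _ k j) (cong₂ _+_ (count-fixed (trees n) k j) (count-arcs n k j))

  times[t-1]z : Coeffs → Coeffs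
  times[t-1]z Q k j = shift2 1 1 Q k j - shift2 0 1 Q k j

  -- P differs from F only on trees of size ≥ 2 starting with a fixed point,
  -- which carry an extra 312 at the opener of an enclosing arc.
  Δ : ℕ → Coeffs
  Δ (suc (suc a)) = times[t-1]z (F (suc a))
  Δ _ k j = 0ℤ

  P≡F+Δ : ∀ a k j → P a k j ≡ F a k j + Δ a k j
  P≡F+Δ zero k j = sym (+-identityʳ _)
  P≡F+Δ (suc zero) k j = sym (+-identityʳ _)
  P≡F+Δ (suc (suc a)) k j = begin
    count arcStat (map fixed T ++ A) k j                ≡⟨ count-++ arcStat (map fixed T) A k j ⟩
    count arcStat (map fixed T) k j + count arcStat A k j ≡⟨ cong₂ _+_ fixed-part arc-part ⟩
    shift2 1 1 (F (suc a)) k j + count occT A k j       ≡⟨ regroup (shift2 1 1 (F (suc a)) k j) (shift2 0 1 (F (suc a)) k j) (count occT A k j) ⟩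
    (shift2 0 1 (F (suc a)) k j + count occT A k j) + times[t-1]z (F (suc a)) k j
      ≡⟨ cong (_+ times[t-1]z (F (suc a)) k j) fixed-or-arc ⟨
    F (suc (suc a)) k j + Δ (suc (suc a)) k j          ∎
    where
    open ≡-Reasoning
    T = trees (suc a)
    A = arcs (treesWithFuel (suc (suc a))) (suc a)
    regroup : ∀ x y z → x + z ≡ (y + z) + (x - y)
    regroup = solve-∀
    fixed-or-arc : F (suc (suc a)) k j ≡ shift2 0 1 (F (suc a)) k j + count occT A k j
    fixed-or-arc = trans (count-++ occT (map fixed T) A k j) (cong (_+ count occT A k j) (count-fixed T k j))
    opener-312 : ∀ {s} → s ∈ T → arcStat (fixed s) ≡ suc (occT s)
    opener-312 {leaf} s∈ with size-of-member (suc (suc a)) (suc a) s∈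
    ... | ()
    opener-312 {fixed _} _ = refl
    opener-312 {arc _ _} _ = refl
    fixed-part : count arcStat (map fixed T) k j ≡ shift2 1 1 (F (suc a)) k j
    fixed-part = trans (cong +_ (trans (countB-map (withStats arcStat k j) fixed T)
                   (countB-cong _ (λ s → (suc (occT s) ≡ᵇ k) ∧ (suc (fixT s) ≡ᵇ j)) T
                     (λ {s} s∈ → cong (λ x → (x ≡ᵇ k) ∧ (suc (fixT s) ≡ᵇ j)) (opener-312 s∈)))))
                   (count-raised 1 1 occT fixT T k j)
    arc-part : count arcStat A k j ≡ count occT A k j
    arc-part = cong +_ (countB-cong (withStats arcStat k j) (withStats occT k j) A no-opener)
      where
      no-opener : ∀ {t} → t ∈ A → withStats arcStat k j t ≡ withStats occT k j t
      no-opener t∈ with ∈-arcs (treesWithFuel (suc (suc a))) (suc a) t∈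
      ... | _ , _ , _ , _ , _ , _ , refl = refl

  shift2-cong : ∀ e₂ e₃ {Q Q′ : Coeffs} k j → (∀ b c → Q b c ≡ Q′ b c) → shift2 e₂ e₃ Q k j ≡ shift2 e₂ e₃ Q′ k j
  shift2-cong e₂ e₃ k j e = shift-cong e₂ k (λ k′ → shift-cong e₃ j (e k′))

  sumTo-shift2 : ∀ m e₂ e₃ (G : ℕ → Coeffs) k j →
    sumTo m (λ a → shift2 e₂ e₃ (G a) k j) ≡ shift2 e₂ e₃ (λ k′ j′ → sumTo m (λ a → G a k′ j′)) k j
  sumTo-shift2 m e₂ e₃ G k j =
    trans (sumTo-shift m e₂ (λ a k′ → shift e₃ (G a k′) j) k) (shift-cong e₂ k (λ k′ → sumTo-shift m e₃ (λ a → G a k′) j))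

  sumTo-times[t-1]z : ∀ m (G : ℕ → Coeffs) k j →
    sumTo m (λ a → times[t-1]z (G a) k j) ≡ times[t-1]z (λ k′ j′ → sumTo m (λ a → G a k′ j′)) k j
  sumTo-times[t-1]z m G k j = trans (sumTo-- m _ _) (cong₂ _-_ (sumTo-shift2 m 1 1 G k j) (sumTo-shift2 m 0 1 G k j))

  conv2-times[t-1]z : ∀ (P Q : Coeffs) k j → conv2 (times[t-1]z P) Q k j ≡ times[t-1]z (conv2 P Q) k j
  conv2-times[t-1]z P Q k j =
    trans (conv2--ˡ (shift2 1 1 P) (shift2 0 1 P) Q k j) (cong₂ _-_ (conv2-shift 1 1 P Q k j) (conv2-shift 0 1 P Q k j))

  -- F 0 is the unit of the product: only the empty tree has size 0.
  conv2-F0 : ∀ (Q : Coeffs) k j → conv2 (F 0) Q k j ≡ Q k j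
  conv2-F0 Q k j = trans (conv2-congˡ {P′ = point2 0 0} Q k j (λ b c → trans (count-cons occT leaf [] b c) (+-identityʳ _))) (conv2-point 0 0 Q k j)

  shift3 : ℕ → ℕ → ℕ → Series → Series
  shift3 e₁ e₂ e₃ h n k j = shift e₁ (λ n′ → shift2 e₂ e₃ (h n′) k j) n

  times[t-1]x³z : Series → Series
  times[t-1]x³z h n k j = shift3 3 1 1 h n k j - shift3 3 0 1 h n k j

  -- The arcs whose inner block starts with a fixed point contribute the correction x³ (t - 1) z (F² - F).
  Δ-sum : ∀ m k j → sumTo m (λ a → conv2 (Δ a) (F (m ∸ a)) k j) ≡
                    times[t-1]x³z (F ⊗ F) (2 ℕ.+ m) k j - times[t-1]x³z F (2 ℕ.+ m) k j
  Δ-sum zero k j = conv2-zeroˡ (F 0) k j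
  Δ-sum (suc m) k j = begin
    sumTo (suc m) (λ a → conv2 (Δ a) (F (suc m ∸ a)) k j)
      ≡⟨ sumTo-head m _ ⟩
    conv2 (Δ 0) (F (suc m)) k j + sumTo m (λ a → conv2 (Δ (suc a)) (F (m ∸ a)) k j)
      ≡⟨ cong₂ _+_ (conv2-zeroˡ (F (suc m)) k j) (sumTo-drop-first m _ Z (conv2-zeroˡ (F m) k j) inner-starts-fixed) ⟩
    0ℤ + (sumTo m Z - Z 0)
      ≡⟨ +-identityˡ _ ⟩
    sumTo m Z - Z 0
      ≡⟨ cong₂ _-_ (sumTo-times[t-1]z m (λ a → conv2 (F a) (F (m ∸ a))) k j)
                   (cong₂ _-_ (shift2-cong 1 1 k j (conv2-F0 (F m))) (shift2-cong 0 1 k j (conv2-F0 (F m)))) ⟩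
    times[t-1]z ((F ⊗ F) m) k j - times[t-1]z (F m) k j ∎
    where
    open ≡-Reasoning
    Z : ℕ → ℤ
    Z a = times[t-1]z (conv2 (F a) (F (m ∸ a))) k j
    inner-starts-fixed : ∀ a → conv2 (Δ (suc (suc a))) (F (m ∸ suc a)) k j ≡ Z (suc a)
    inner-starts-fixed a = conv2-times[t-1]z (F (suc a)) (F (m ∸ suc a)) k j

  arc-sum : ∀ m k j → sumTo m (λ a → conv2 (P a) (F (m ∸ a)) k j) ≡
                      (F ⊗ F) m k j + (times[t-1]x³z (F ⊗ F) (2 ℕ.+ m) k j - times[t-1]x³z F (2 ℕ.+ m) k j)
  arc-sum m k j =
    trans (sumTo-cong′ m (λ a → trans (conv2-congˡ (F (m ∸ a)) k j (P≡F+Δ a)) (conv2-+ˡ (F a) (Δ a) (F (m ∸ a)) k j)))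
          (trans (sumTo-+ m _ _) (cong (_+_ ((F ⊗ F) m k j)) (Δ-sum m k j)))

  -- The right-hand side of the functional equation  F = 1 + x z F + x² F² + x³ (t - 1) z (F² - F).
  Φ : Series → Series
  Φ h n k j = coefC n k j + shift3 1 0 1 h n k j + shift3 2 0 0 (h ⊗ h) n k j
              + (times[t-1]x³z (h ⊗ h) n k j - times[t-1]x³z h n k j)

  F-recurrence : ∀ n k j → F n k j ≡ Φ F n k j
  F-recurrence zero zero zero = refl
  F-recurrence zero zero (suc j) = refl
  F-recurrence zero (suc k) zero = refl
  F-recurrence zero (suc k) (suc j) = refl
  F-recurrence (suc zero) k j = trans (F-suc 0 k j) (only-fixed (shift2 0 1 (F 0) k j))
    where
    only-fixed : ∀ y → y + 0ℤ ≡ 0ℤ + y + 0ℤ + ((0ℤ - 0ℤ) - (0ℤ - 0ℤ))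
    only-fixed = solve-∀
  F-recurrence (suc (suc m)) k j = trans (F-suc (suc m) k j) (trans (cong (_+_ (shift2 0 1 (F (suc m)) k j)) (arc-sum m k j))
    (fixed-or-arc (shift2 0 1 (F (suc m)) k j) ((F ⊗ F) m k j)
                  (times[t-1]x³z (F ⊗ F) (2 ℕ.+ m) k j) (times[t-1]x³z F (2 ℕ.+ m) k j)))
    where
    fixed-or-arc : ∀ y x c₁ c₂ → y + (x + (c₁ - c₂)) ≡ 0ℤ + y + x + (c₁ - c₂)
    fixed-or-arc = solve-∀

  F312≡F : ∀ n k j → F312 n k j ≡ F n k j
  F312≡F n k j = cong +_ (coeffF≡tree-count n k j)

  ⊗-cong : ∀ {f f′ g g′ : Series} → (∀ n k j → f n k j ≡ f′ n k j) → (∀ n k j → g n k j ≡ g′ n k j) →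
           ∀ n k j → (f ⊗ g) n k j ≡ (f′ ⊗ g′) n k j
  ⊗-cong {f′ = f′} {g} f≡ g≡ n k j = sumTo-cong′ n (λ a →
    trans (conv2-congˡ (g (n ∸ a)) k j (f≡ a)) (conv2-congʳ (f′ a) k j (g≡ (n ∸ a))))

  shift3-cong : ∀ e₁ e₂ e₃ {h h′ : Series} → (∀ n k j → h n k j ≡ h′ n k j) → ∀ n k j → shift3 e₁ e₂ e₃ h n k j ≡ shift3 e₁ e₂ e₃ h′ n k j
  shift3-cong e₁ e₂ e₃ h≡ n k j = shift-cong e₁ n (λ n′ → shift2-cong e₂ e₃ k j (h≡ n′))

  Φ-cong : ∀ {h h′ : Series} → (∀ n k j → h n k j ≡ h′ n k j) → ∀ n k j → Φ h n k j ≡ Φ h′ n k j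
  Φ-cong h≡ n k j = cong₂ _+_ (cong₂ _+_ (cong (_+_ (coefC n k j)) (shift3-cong 1 0 1 h≡ n k j)) (shift3-cong 2 0 0 hh≡ n k j))
    (cong₂ _-_ (cong₂ _-_ (shift3-cong 3 1 1 hh≡ n k j) (shift3-cong 3 0 1 hh≡ n k j))
               (cong₂ _-_ (shift3-cong 3 1 1 h≡ n k j) (shift3-cong 3 0 1 h≡ n k j)))
    where hh≡ = ⊗-cong h≡ h≡

  F312-recurrence : ∀ n k j → F312 n k j ≡ Φ F312 n k j
  F312-recurrence n k j = trans (F312≡F n k j) (trans (F-recurrence n k j) (sym (Φ-cong F312≡F n k j)))

  ⊗-distribʳ : ∀ (f g h : Series) n k j → ((f ⊕ g) ⊗ h) n k j ≡ (f ⊗ h) n k j + (g ⊗ h) n k j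
  ⊗-distribʳ f g h n k j = trans (sumTo-cong′ n (λ a → conv2-+ˡ (f a) (g a) (h (n ∸ a)) k j)) (sumTo-+ n _ _)

  mono-⊗ : ∀ c e₁ e₂ e₃ (h : Series) n k j → (mono c e₁ e₂ e₃ ⊗ h) n k j ≡ c * shift3 e₁ e₂ e₃ h n k j
  mono-⊗ c e₁ e₂ e₃ h n k j = begin
    (mono c e₁ e₂ e₃ ⊗ h) n k j
      ≡⟨ sumTo-cong′ n layer ⟩
    sumTo n (λ a → if a ≡ᵇ e₁ then c * shift2 e₂ e₃ (h (n ∸ a)) k j else 0ℤ)
      ≡⟨ sumTo-point n e₁ (λ a → c * shift2 e₂ e₃ (h (n ∸ a)) k j) ⟩
    (if e₁ <ᵇ suc n then c * shift2 e₂ e₃ (h (n ∸ e₁)) k j else 0ℤ)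
      ≡⟨ shift-as-if e₁ (λ n′ → c * shift2 e₂ e₃ (h n′) k j) n ⟩
    shift e₁ (λ n′ → c * shift2 e₂ e₃ (h n′) k j) n
      ≡⟨ shift-*ˡ e₁ c (λ n′ → shift2 e₂ e₃ (h n′) k j) n ⟩
    c * shift3 e₁ e₂ e₃ h n k j ∎
    where
    open ≡-Reasoning
    scaled-point : ∀ (Q : Coeffs) b d → (if (b ≡ᵇ e₂) ∧ (d ≡ᵇ e₃) then c else 0ℤ) * Q b d ≡ point2 e₂ e₃ b d * (c * Q b d)
    scaled-point Q b d rewrite ≡ᵇ-sym e₂ b | ≡ᵇ-sym e₃ d with (b ≡ᵇ e₂) ∧ (d ≡ᵇ e₃)
    ... | true = sym (*-identityˡ _)
    ... | false = refl
    layer : ∀ a → conv2 (mono c e₁ e₂ e₃ a) (h (n ∸ a)) k j ≡ (if a ≡ᵇ e₁ then c * shift2 e₂ e₃ (h (n ∸ a)) k j else 0ℤ)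
    layer a with a ≡ᵇ e₁
    ... | true = trans (sumTo-cong′ k (λ b → sumTo-cong′ j (λ d → scaled-point (λ b′ d′ → h (n ∸ a) (k ∸ b′) (j ∸ d′)) b d)))
      (trans (conv2-point e₂ e₃ (λ b d → c * h (n ∸ a) b d) k j)
             (trans (shift-cong e₂ k (λ k′ → shift-*ˡ e₃ c (h (n ∸ a) k′) j)) (shift-*ˡ e₂ c _ k)))
    ... | false = conv2-zeroˡ (h (n ∸ a)) k j

  mono-⊕-⊗ : ∀ c e₁ e₂ e₃ (g h : Series) n k j → ((mono c e₁ e₂ e₃ ⊕ g) ⊗ h) n k j ≡ c * shift3 e₁ e₂ e₃ h n k j + (g ⊗ h) n k j
  mono-⊕-⊗ c e₁ e₂ e₃ g h n k j = trans (⊗-distribʳ (mono c e₁ e₂ e₃) g h n k j) (cong (_+ (g ⊗ h) n k j) (mono-⊗ c e₁ e₂ e₃ h n k j))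

  coefA-⊗ : ∀ h n k j → (coefA ⊗ h) n k j ≡ one * shift3 3 1 1 h n k j + (one * shift3 2 0 0 h n k j + minusOne * shift3 3 0 1 h n k j)
  coefA-⊗ h n k j =
    trans (mono-⊕-⊗ one 3 1 1 (mono one 2 0 0 ⊕ mono minusOne 3 0 1) h n k j) (cong (_+_ (one * shift3 3 1 1 h n k j))
    (trans (mono-⊕-⊗ one 2 0 0 (mono minusOne 3 0 1) h n k j) (cong (_+_ (one * shift3 2 0 0 h n k j))
    (mono-⊗ minusOne 3 0 1 h n k j))))

  coefB-⊗ : ∀ h n k j → (coefB ⊗ h) n k j ≡ one * shift3 1 0 1 h n k j + (one * shift3 2 0 0 h n k j + (one * shift3 3 0 1 h n k j
              + (minusOne * shift3 3 1 1 h n k j + (minusOne * shift3 2 0 0 h n k j + minusOne * h n k j))))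
  coefB-⊗ h n k j =
    trans (mono-⊕-⊗ one 1 0 1 B₂ h n k j) (cong (_+_ (one * shift3 1 0 1 h n k j))
    (trans (mono-⊕-⊗ one 2 0 0 B₃ h n k j) (cong (_+_ (one * shift3 2 0 0 h n k j))
    (trans (mono-⊕-⊗ one 3 0 1 B₄ h n k j) (cong (_+_ (one * shift3 3 0 1 h n k j))
    (trans (mono-⊕-⊗ minusOne 3 1 1 B₅ h n k j) (cong (_+_ (minusOne * shift3 3 1 1 h n k j))
    (trans (mono-⊕-⊗ minusOne 2 0 0 B₆ h n k j) (cong (_+_ (minusOne * shift3 2 0 0 h n k j))
    (mono-⊗ minusOne 0 0 0 h n k j))))))))))
    where
    B₆ = mono minusOne 0 0 0
    B₅ = mono minusOne 2 0 0 ⊕ B₆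
    B₄ = mono minusOne 3 1 1 ⊕ B₅
    B₃ = mono one 3 0 1 ⊕ B₄
    B₂ = mono one 2 0 0 ⊕ B₃

  Φ-fixed-point⇒quadratic : ∀ (h : Series) n k j → h n k j ≡ Φ h n k j →
    ((coefA ⊗ (h ⊗ h)) ⊕ ((coefB ⊗ h) ⊕ coefC)) n k j ≡ 0ℤ
  Φ-fixed-point⇒quadratic h n k j h≡Φh =
    trans (cong₂ _+_ (coefA-⊗ (h ⊗ h) n k j) (cong (_+ coefC n k j) (coefB-⊗ h n k j)))
          (trans (cong (λ x → A + ((B x) + coefC n k j)) h≡Φh)
                 (identity (coefC n k j) (s 1 0 1 h) (s 2 0 0 h) (s 3 0 1 h) (s 3 1 1 h) (s 2 0 0 (h ⊗ h)) (s 3 0 1 (h ⊗ h)) (s 3 1 1 (h ⊗ h))))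
    where
    s : ℕ → ℕ → ℕ → Series → ℤ
    s e₁ e₂ e₃ g = shift3 e₁ e₂ e₃ g n k j
    A : ℤ
    A = one * s 3 1 1 (h ⊗ h) + (one * s 2 0 0 (h ⊗ h) + minusOne * s 3 0 1 (h ⊗ h))
    B : ℤ → ℤ
    B x = one * s 1 0 1 h + (one * s 2 0 0 h + (one * s 3 0 1 h + (minusOne * s 3 1 1 h + (minusOne * s 2 0 0 h + minusOne * x))))
    -- after substituting h = Φ h the expression is identically zero
    identity : ∀ c a₁ a₂ a₃ a₄ b₂ b₃ b₄ →
      (one * b₄ + (one * b₂ + minusOne * b₃)) +
      ((one * a₁ + (one * a₂ + (one * a₃ + (minusOne * a₄ + (minusOne * a₂ + minusOne * (c + a₁ + b₂ + ((b₄ - b₃) - (a₄ - a₃)))))))) + c) ≡ 0ℤ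
    identity = solve-∀

open GeneratingFunction using (Φ-fixed-point⇒quadratic; F312-recurrence)

theorem4p5 : ∀ n k j →
    ((coefA ⊗ (F312 ⊗ F312)) ⊕ ((coefB ⊗ F312) ⊕ coefC)) n k j ≡ zeroS n k j
theorem4p5 n k j = Φ-fixed-point⇒quadratic F312 n k j (F312-recurrence n k j)
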